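{- For every finite graph $G$ with maximum degree $\Delta\ge 1$, $$\pi_{\operatorname{ch}}(G)\le \Delta^2+\frac{3}{2^{2/3}}\Delta^{5/3}+2^{2/3}\Delta^{4/3}.$$
   Context: A sequence $s_1\ldots s_{2k}$ ($k\ge1$) is a square if $s_i=s_{i+k}$ for all $i$; a sequence is non-repetitive if it has no consecutive subsequence that is a square. A vertex coloring of a graph is non-repetitive if the color sequence of every (simple) path is non-repetitive. A list assignment $L$ assigns to each vertex $v$ a set $L(v)$ of colors; $G$ is non-repetitively $l$-choosable if for every list assignment with all lists of size at least $l$ there is a non-repetitive coloring in which every vertex $v$ gets a color from $L(v)$. The non-repetitive choice number $\pi_{\operatorname{ch}}(G)$ is the smallest such $l$. -}

module Defs where

open import Data.Nat as ℕ using (ℕ; zero; suc; _⊔_)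
open import Data.Bool using (Bool; true; false)
open import Data.Fin using (Fin)
open import Data.List using (List; []; _∷_; _++_; map; length; foldr; filter)
open import Data.List.Base using (allFin)
open import Data.List.Membership.Propositional using (_∈_)
open import Data.List.Relation.Unary.Unique.Propositional using (Unique)
open import Data.Product using (Σ; ∃; _×_; _,_)
open import Data.Integer using (+_)
open import Data.Rational as ℚ using (ℚ; _/_)
open import Relation.Binary.PropositionalEquality using (_≡_; _≢_)
open import Relation.Nullary using (¬_)
open import Data.Bool.Properties using (T?)
open import Data.Bool using (T)

record Graph (n : ℕ) : Set where
  field
    adj       : Fin n → Fin n → Bool
    symmetric : ∀ u v → adj u v ≡ adj v u
    loopless  : ∀ v → adj v v ≡ false
open Graph public

degree : ∀ {n} → Graph n → Fin n → ℕ
degree G v = length (filter (λ u → T? (adj G v u)) (allFin _))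

maxDegree : ∀ {n} → Graph n → ℕ
maxDegree G = foldr (λ v m → degree G v ⊔ m) 0 (allFin _)

Consecutive : ∀ {n} → Graph n → List (Fin n) → Set
Consecutive G []            = Data.Unit.⊤ where import Data.Unit
Consecutive G (u ∷ [])      = Data.Unit.⊤ where import Data.Unit
Consecutive G (u ∷ v ∷ vs)  = T (adj G u v) × Consecutive G (v ∷ vs)

IsPath : ∀ {n} → Graph n → List (Fin n) → Set
IsPath G p = (p ≢ []) × Unique p × Consecutive G p

NonRepetitive : {A : Set} → List A → Set
NonRepetitive s = ∀ as ys bs → ys ≢ [] → s ≢ as ++ ys ++ ys ++ bs

NonRepColoring : ∀ {n} → Graph n → (Fin n → ℕ) → Set
NonRepColoring G c = ∀ p → IsPath G p → NonRepetitive (map c p)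

NonRepChoosable : ∀ {n} → Graph n → ℕ → Set
NonRepChoosable {n} G l =
  (L : Fin n → List ℕ) →
  (∀ v → Unique (L v) × l ℕ.≤ length (L v)) →
  Σ (Fin n → ℕ) λ c → (∀ v → c v ∈ L v) × NonRepColoring G c

ℕtoℚ : ℕ → ℚ
ℕtoℚ k = + k / 1

-- l ≤ Δ² + (3/2^{2/3}) Δ^{5/3} + 2^{2/3} Δ^{4/3}.
-- With y = (Δ/2)^{1/3} the right side equals Δ² + 3Δy² + 2Δy, which is
-- continuous and increasing in y > 0; so the real inequality is equivalent
-- to: for every rational q with Δ ≤ 2q³, l ≤ Δ² + 3Δq² + 2Δq.
BoundHolds : ℕ → ℕ → Set
BoundHolds Δ l =
  ∀ (q : ℚ) → ℕtoℚ Δ ℚ.≤ ℕtoℚ 2 ℚ.* (q ℚ.* q ℚ.* q) →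
  ℕtoℚ l ℚ.≤ ℕtoℚ (Δ ℕ.* Δ)
             ℚ.+ ℕtoℚ (3 ℕ.* Δ) ℚ.* (q ℚ.* q)
             ℚ.+ ℕtoℚ (2 ℕ.* Δ) ℚ.* q

-- Counting argument in the style of Rosenfeld.  Let C(S) be the number of colourings of a vertex
-- set S from the lists under which no path inside S carries a square, and β = (Δ - 1)² + e.
-- We show C(S) ≥ β C(S - v) for v ∈ S by induction on |S|.  Each square-free colouring of S - v
-- has at least β + c extensions to v; an extension is bad only if it creates a square path
-- through v, with v in the first half H of the path after reversing it if necessary.  The
-- colours on H repeat those on the second half, so a bad extension is determined by a
-- square-free colouring of S - H, and by induction C(S - H) ≤ β^(1-k) C(S - v) for |H| = k.
-- There are at most kΔ(Δ - 1)^(2k-2) candidate paths, so there are at most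
-- Σ_k kΔ((Δ - 1)²/β)^(k-1) C(S - v) ≤ Δ(β/e)² C(S - v) ≤ c C(S - v) bad extensions, and
-- C(V) ≥ βⁿ > 0.  Taking e ≈ (2Δ⁵)^(1/3) and c ≈ Δβ²/e² makes the list size β + c at most
-- Δ² + 3Δq² + 2Δq whenever Δ ≤ 2q³.

module Submission where

open import Data.Bool using (T)
open import Data.Bool.Properties using (T?)
open import Data.Fin using (Fin; _≟_)
import Data.Integer as ℤ
open import Data.List using (List; []; _∷_; _++_; [_]; map; length; filter; concatMap; foldr; reverse; reverseAcc; take; drop; upTo; downFrom; head)
open import Data.List.Base using (allFin)
open import Data.List.Membership.Propositional using (_∈_; _∉_; find; lose)
open import Data.List.Membership.Propositional.Properties
  using (∈-filter⁺; ∈-filter⁻; ∈-concatMap⁺; ∈-concatMap⁻; ∈-map⁺; ∈-map⁻; ∈-allFin; ∈-upTo⁺; ∈-upTo⁻; ∈-downFrom⁺; ∈-∃++; ∈-++⁺ˡ; ∈-++⁺ʳ; ∈-++⁻)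
open import Data.List.Properties
  using (map-cong; map-cong-local; ∷-injectiveˡ; ∷-injectiveʳ; length-++; length-map; length-tabulate; length-upTo; length-take; length-drop; length-reverse;
         ++-assoc; take++drop≡id; take-map; drop-map; reverse-++; reverse-map; reverse-involutive; unfold-reverse; ≡-dec;
         length-filter; filter-notAll; filter-≐; filter-all; filter-none; filter-accept; filter-reject)
import Data.List.Relation.Unary.All as All
import Data.List.Relation.Unary.All.Properties as Allₚ
open import Data.List.Relation.Unary.Any using (Any; here; there; any?)
import Data.List.Relation.Unary.Any as Any
open import Data.List.Relation.Unary.Any.Properties using (reverse⁻)
import Data.List.Relation.Binary.Permutation.Setoid.Properties as Permutation
open import Data.List.Relation.Unary.Unique.Propositional.Properties using (Unique[x∷xs]⇒x∉xs; filter⁺; take⁺; allFin⁺)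
open import Data.Maybe using (Maybe; just; nothing)
open import Data.Nat using (ℕ; zero; suc; _+_; _*_; _∸_; _^_; _⊔_; _⊓_; pred; _≤_; _<_; z≤n; s≤s; _≤?_; _<?_; _/_; _%_; NonZero; >-nonZero)
import Data.Nat as ℕ
open import Data.Nat.DivMod using (m≡m%n+[m/n]*n; m%n<n; m/n*n≤m)
open import Data.Nat.ListAction using (sum)
open import Data.Nat.Properties hiding (_≟_)
open import Algebra.Properties.CommutativeSemigroup +-commutativeSemigroup using (interchange)
open import Algebra.Properties.CommutativeSemigroup *-commutativeSemigroup using (x∙yz≈y∙xz; xy∙z≈y∙xz; x∙yz≈yx∙z)
open import Data.Nat.Tactic.RingSolver using (solve; solve-∀)
open import Data.Product using (Σ; ∃; ∃-syntax; _×_; _,_; proj₁; proj₂)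
open import Data.Rational as ℚ using (ℚ; mkℚ; toℚᵘ)
open import Data.Rational.Properties using (toℚᵘ-fromℚᵘ; toℚᵘ-homo-+; toℚᵘ-homo-*; toℚᵘ-mono-≤; toℚᵘ-cancel-≤)
open import Data.Rational.Unnormalised as ℚᵘ using (ℚᵘ; mkℚᵘ; *≤*; _≃_) renaming (_≤_ to _≤ᵘ_; _+_ to _+ᵘ_; _*_ to _*ᵘ_)
open import Data.Rational.Unnormalised.Properties using (≃-refl; ≃-sym; ≃-trans; +-cong; *-cong; ≤-respˡ-≃; ≤-respʳ-≃)
open import Data.Sum using ([_,_]′)
open import Data.Unit using (⊤; tt)
open import Data.Vec using (Vec; lookup; replicate; _[_]≔_)
open import Data.Vec.Properties using ([]≔-commutes; lookup∘update; lookup∘update′)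
open import Defs
open import Function using (_∘_; id)
open import Level using (0ℓ)
open import Relation.Binary.Definitions using (DecidableEquality)
open import Relation.Binary.PropositionalEquality hiding ([_])
open import Relation.Binary.PropositionalEquality.Properties using (setoid)
open import Relation.Nullary using (¬_; Dec; yes; no; ¬?; contradiction)
open import Relation.Nullary.Decidable using (_×-dec_; map′; decidable-stable)
open import Relation.Unary using (Pred; Decidable)

private variable A B : Set

sumMap : (A → ℕ) → List A → ℕ
sumMap f xs = sum (map f xs)

sumMap-+ : (f g : A → ℕ) (xs : List A) → sumMap (λ x → f x + g x) xs ≡ sumMap f xs + sumMap g xs
sumMap-+ f g []       = refl
sumMap-+ f g (x ∷ xs) = trans (cong (f x + g x +_) (sumMap-+ f g xs)) (interchange (f x) (g x) _ _)

sumMap-*ˡ : (k : ℕ) (f : A → ℕ) (xs : List A) → sumMap (λ x → k * f x) xs ≡ k * sumMap f xs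
sumMap-*ˡ k f []       = sym (*-zeroʳ k)
sumMap-*ˡ k f (x ∷ xs) = trans (cong (k * f x +_) (sumMap-*ˡ k f xs)) (sym (*-distribˡ-+ k (f x) _))

sumMap-const : (k : ℕ) (xs : List A) → sumMap (λ _ → k) xs ≡ length xs * k
sumMap-const k []       = refl
sumMap-const k (x ∷ xs) = cong (k +_) (sumMap-const k xs)

sumMap-cong : {f g : A → ℕ} → (∀ x → f x ≡ g x) → (xs : List A) → sumMap f xs ≡ sumMap g xs
sumMap-cong f≗g xs = cong sum (map-cong f≗g xs)

sumMap-mono : (f g : A → ℕ) (xs : List A) → (∀ {x} → x ∈ xs → f x ≤ g x) → sumMap f xs ≤ sumMap g xs
sumMap-mono f g []       f≤g = z≤n
sumMap-mono f g (x ∷ xs) f≤g = +-mono-≤ (f≤g (here refl)) (sumMap-mono f g xs (f≤g ∘ there))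

sumMap-≤-length* : (f : A → ℕ) (k : ℕ) (xs : List A) → (∀ {x} → x ∈ xs → f x ≤ k) → sumMap f xs ≤ length xs * k
sumMap-≤-length* f k xs f≤k = ≤-trans (sumMap-mono f (λ _ → k) xs f≤k) (≤-reflexive (sumMap-const k xs))

term≤sumMap : (f : A → ℕ) {xs : List A} {x : A} → x ∈ xs → f x ≤ sumMap f xs
term≤sumMap f {y ∷ xs} (here refl) = m≤m+n (f y) _
term≤sumMap f {y ∷ xs} (there x∈) = ≤-trans (term≤sumMap f x∈) (m≤n+m _ (f y))

sumMap-zero : (xs : List A) → sumMap (λ _ → 0) xs ≡ 0
sumMap-zero xs = sumMap-*ˡ 0 (λ _ → 0) xs

sumMap-comm : (g : A → B → ℕ) (xs : List A) (ys : List B) →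
  sumMap (λ x → sumMap (g x) ys) xs ≡ sumMap (λ y → sumMap (λ x → g x y) xs) ys
sumMap-comm g []       ys = sym (sumMap-zero ys)
sumMap-comm g (x ∷ xs) ys =
  trans (cong (sumMap (g x) ys +_) (sumMap-comm g xs ys)) (sym (sumMap-+ (g x) _ ys))

sumMap-pos : (f : A → ℕ) (xs : List A) → 0 < sumMap f xs → ∃[ x ] x ∈ xs × 0 < f x
sumMap-pos f (x ∷ xs) pos with f x in fx
... | suc _ = x , here refl , subst (0 <_) (sym fx) (s≤s z≤n)
... | zero  with sumMap-pos f xs pos
...   | y , y∈ , fy>0 = y , there y∈ , fy>0

length-concatMap : (f : A → List B) (xs : List A) → length (concatMap f xs) ≡ sumMap (length ∘ f) xs
length-concatMap f []       = refl
length-concatMap f (x ∷ xs) = trans (length-++ (f x)) (cong (length (f x) +_) (length-concatMap f xs))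

∈-concatMap⁺′ : (f : A → List B) {xs : List A} {x : A} {y : B} → x ∈ xs → y ∈ f x → y ∈ concatMap f xs
∈-concatMap⁺′ f x∈ y∈ = ∈-concatMap⁺ f (lose x∈ y∈)

∈-concatMap⁻′ : (f : A → List B) {xs : List A} {y : B} → y ∈ concatMap f xs → ∃[ x ] x ∈ xs × y ∈ f x
∈-concatMap⁻′ f y∈ = find (∈-concatMap⁻ f y∈)

^-cancelˡ-≤ : ∀ k .{{_ : NonZero k}} {a b} → a ^ k ≤ b ^ k → a ≤ b
^-cancelˡ-≤ k {a} {b} aᵏ≤bᵏ with a ≤? b
... | yes a≤b = a≤b
... | no  a≰b = contradiction aᵏ≤bᵏ (<⇒≱ (^-monoˡ-< k (≰⇒> a≰b)))

root : ∀ k .{{_ : NonZero k}} x → ∃[ r ] r ^ k ≤ x × x < suc r ^ k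
root k@(suc _) zero = 0 , z≤n , ≤-reflexive (sym (^-zeroˡ k))
root k (suc x)      with root k x
... | r , rᵏ≤x , x<r+1ᵏ with suc r ^ k ≤? suc x
...   | yes r+1ᵏ≤x+1 = suc r , r+1ᵏ≤x+1 , ≤-<-trans x<r+1ᵏ (^-monoˡ-< k (n<1+n (suc r)))
...   | no  r+1ᵏ≰x+1 = r , m≤n⇒m≤1+n rᵏ≤x , ≰⇒> r+1ᵏ≰x+1

^-double : ∀ m k → m ^ (k + k) ≡ (m * m) ^ k
^-double m zero    = refl
^-double m (suc k) = begin
  m * m ^ (k + suc k)   ≡⟨ cong (λ i → m * m ^ i) (+-suc k k) ⟩
  m * (m * m ^ (k + k)) ≡⟨ *-assoc m m _ ⟨
  m * m * m ^ (k + k)   ≡⟨ cong (m * m *_) (^-double m k) ⟩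
  m * m * (m * m) ^ k   ∎
  where open ≡-Reasoning

cube≡^3 : ∀ x → x * x * x ≡ x ^ 3
cube≡^3 x = trans (*-assoc x x x) (cong (λ y → x * (x * y)) (sym (*-identityʳ x)))

cube-cancel-≤ : ∀ {a b} → a * a * a ≤ b * b * b → a ≤ b
cube-cancel-≤ {a} {b} a³≤b³ = ^-cancelˡ-≤ 3 (subst₂ _≤_ (cube≡^3 a) (cube≡^3 b) a³≤b³)

-- The series bound

module _ (D e : ℕ) where

  private
    β = D + e

  -- series K = Σ_{k<K} (k + 1) Dᵏ β^(K-1-k)
  series : ℕ → ℕ
  series zero    = 0
  series (suc K) = β * series K + suc K * D ^ K

  series-identity : ∀ K → e * e * series K + suc K * D ^ K * β ≡ β ^ suc K + K * D ^ suc K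
  series-identity zero    = base D e
    where
    base : ∀ D e → e * e * 0 + 1 * 1 * (D + e) ≡ (D + e) * 1 + 0 * (D * 1)
    base = solve-∀
  series-identity (suc K) = +-cancelʳ-≡ (β * (β ^ suc K + K * D ^ suc K)) _ _ (begin
    e * e * series (suc K) + suc (suc K) * D ^ suc K * β + β * (β ^ suc K + K * D ^ suc K)
      ≡⟨ step e D (series K) (D ^ K) (β ^ K) K ⟩
    β ^ suc (suc K) + suc K * D ^ suc (suc K) + β * (e * e * series K + suc K * D ^ K * β)
      ≡⟨ cong (λ t → β ^ suc (suc K) + suc K * D ^ suc (suc K) + β * t) (series-identity K) ⟩
    β ^ suc (suc K) + suc K * D ^ suc (suc K) + β * (β ^ suc K + K * D ^ suc K) ∎)
    where
    open ≡-Reasoning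
    step : ∀ e D S P B K →
      e * e * ((D + e) * S + (1 + K) * P) + (2 + K) * (D * P) * (D + e) + (D + e) * ((D + e) * B + K * (D * P))
      ≡ (D + e) * ((D + e) * B) + (1 + K) * (D * (D * P)) + (D + e) * (e * e * S + (1 + K) * P * (D + e))
    step = solve-∀

  e²series≤β^suc : ∀ K → e * e * series K ≤ β ^ suc K
  e²series≤β^suc K = +-cancelʳ-≤ (suc K * D ^ K * β) _ _ (begin
    e * e * series K + suc K * D ^ K * β ≡⟨ series-identity K ⟩
    β ^ suc K + K * D ^ suc K             ≤⟨ +-monoʳ-≤ (β ^ suc K) lower ⟩
    β ^ suc K + suc K * D ^ K * β         ∎)
    where
    open ≤-Reasoning
    lower : K * D ^ suc K ≤ suc K * D ^ K * β
    lower = begin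
      K * (D * D ^ K)     ≤⟨ *-mono-≤ (n≤1+n K) (*-monoˡ-≤ (D ^ K) (m≤m+n D e)) ⟩
      suc K * (β * D ^ K) ≡⟨ cong (suc K *_) (*-comm β (D ^ K)) ⟩
      suc K * (D ^ K * β) ≡⟨ *-assoc (suc K) (D ^ K) β ⟨
      suc K * D ^ K * β   ∎

  module _ (X : ℕ → ℕ) (A : ℕ) (X-bound : ∀ k → β ^ k * X k ≤ suc k * D ^ k * A) where

    β^K*sum≤ : ∀ K → β ^ K * sumMap X (downFrom K) ≤ β * series K * A
    β^K*sum≤ zero    = z≤n
    β^K*sum≤ (suc K) = begin
      β * β ^ K * (X K + sumMap X (downFrom K))
        ≡⟨ distrib β (β ^ K) (X K) _ ⟩
      β * (β ^ K * X K) + β * (β ^ K * sumMap X (downFrom K))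
        ≤⟨ +-mono-≤ (*-monoʳ-≤ β (X-bound K)) (*-monoʳ-≤ β (β^K*sum≤ K)) ⟩
      β * (suc K * D ^ K * A) + β * (β * series K * A)
        ≡⟨ collect β (suc K) (D ^ K) A (series K) ⟩
      β * series (suc K) * A ∎
      where
      open ≤-Reasoning
      distrib : ∀ b B x y → b * B * (x + y) ≡ b * (B * x) + b * (B * y)
      distrib = solve-∀
      collect : ∀ b k P A S → b * (k * P * A) + b * (b * S * A) ≡ b * (b * S + k * P) * A
      collect = solve-∀

    -- Σ_k (k + 1) (D/β)ᵏ ≤ (β/e)² with denominators cleared.
    e²*sum≤β²A : 1 ≤ e → ∀ K → e * e * sumMap X (downFrom K) ≤ β * β * A
    e²*sum≤β²A e≥1 K = *-cancelˡ-≤ (β ^ K) {{β^K≢0}} (begin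
      β ^ K * (e * e * sumMap X (downFrom K))
        ≡⟨ x∙yz≈y∙xz (β ^ K) (e * e) (sumMap X (downFrom K)) ⟩
      e * e * (β ^ K * sumMap X (downFrom K))
        ≤⟨ *-monoʳ-≤ (e * e) (β^K*sum≤ K) ⟩
      e * e * (β * series K * A)
        ≡⟨ shuffle₁ (e * e) β (series K) A ⟩
      β * A * (e * e * series K)
        ≤⟨ *-monoʳ-≤ (β * A) (e²series≤β^suc K) ⟩
      β * A * (β * β ^ K)
        ≡⟨ shuffle₂ β A (β ^ K) ⟩
      β ^ K * (β * β * A) ∎)
      where
      open ≤-Reasoning
      shuffle₁ : ∀ E b S A → E * (b * S * A) ≡ b * A * (E * S)
      shuffle₁ = solve-∀
      shuffle₂ : ∀ b A B → b * A * (b * B) ≡ B * (b * b * A)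
      shuffle₂ = solve-∀
      β^K≢0 : NonZero (β ^ K)
      β^K≢0 = >-nonZero (m^n>0 β {{>-nonZero (≤-trans e≥1 (m≤n+m e D))}} K)

-- Choice of the parameters

-- l ≤ Δ² + 3Δq² + 2Δq for every rational q = N/M with Δ ≤ 2q³, with the denominators cleared.
BoundBy : ℕ → ℕ → Set
BoundBy Δ l = ∀ N M → Δ * (M * M * M) ≤ 2 * (N * N * N) → l * (M * M) ≤ Δ * Δ * (M * M) + 3 * Δ * (N * N) + 2 * Δ * N * M

-- If q ≥ 1/a whenever Δ ≤ 2q³, it suffices to check the bound at q = 1/a.
BoundBy-ratio : ∀ {Δ l} a .{{_ : NonZero a}} → (∀ N M → Δ * (M * M * M) ≤ 2 * (N * N * N) → M ≤ a * N) →
  l * (a * a) ≤ Δ * Δ * (a * a) + 3 * Δ + 2 * Δ * a → BoundBy Δ l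
BoundBy-ratio {Δ} {l} a M≤aN l≤ N M q = *-cancelˡ-≤ (a * a) {{m*n≢0 a a}} (begin
  a * a * (l * (M * M))
    ≡⟨ solve (a ∷ l ∷ M ∷ []) ⟩
  l * (a * a) * (M * M)
    ≤⟨ *-monoˡ-≤ (M * M) l≤ ⟩
  (Δ * Δ * (a * a) + 3 * Δ + 2 * Δ * a) * (M * M)
    ≡⟨ solve (Δ ∷ a ∷ M ∷ []) ⟩
  a * a * (Δ * Δ * (M * M)) + 3 * Δ * (M * M) + 2 * Δ * a * (M * M)
    ≤⟨ +-mono-≤ (+-monoʳ-≤ (a * a * (Δ * Δ * (M * M))) (*-monoʳ-≤ (3 * Δ) (*-mono-≤ M≤aN′ M≤aN′)))
                (*-monoʳ-≤ (2 * Δ * a) (*-monoˡ-≤ M M≤aN′)) ⟩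
  a * a * (Δ * Δ * (M * M)) + 3 * Δ * (a * N * (a * N)) + 2 * Δ * a * (a * N * M)
    ≡⟨ solve (a ∷ Δ ∷ N ∷ M ∷ []) ⟩
  a * a * (Δ * Δ * (M * M) + 3 * Δ * (N * N) + 2 * Δ * N * M) ∎)
  where
  open ≤-Reasoning
  M≤aN′ : M ≤ a * N
  M≤aN′ = M≤aN N M q

module _ (Δ D b e c : ℕ) (e≡1+b : e ≡ suc b) (D+Δ+3≤Δ² : D + Δ + 3 ≤ Δ * Δ)
         (b³≤2Δ⁵ : b * b * b ≤ 2 * (Δ * Δ * Δ * Δ * Δ)) (2Δ⁵<e³ : 2 * (Δ * Δ * Δ * Δ * Δ) < e * e * e)
         (ce²≤ : c * (e * e) ≤ Δ * ((D + e) * (D + e)) + e * e) where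

  private
    e≥1 : 1 ≤ e
    e≥1 = subst (1 ≤_) (sym e≡1+b) (s≤s z≤n)

    D≤Δ² : D ≤ Δ * Δ
    D≤Δ² = ≤-trans (≤-trans (m≤m+n D Δ) (m≤m+n (D + Δ) 3)) D+Δ+3≤Δ²

    2ce≤ : 2 * c * e ≤ e * e + 4 * (Δ * Δ * Δ) + 2 * Δ * e + 2 * e
    2ce≤ = *-cancelˡ-≤ e {{>-nonZero e≥1}} (begin
      e * (2 * c * e)                                                   ≡⟨ solve (e ∷ c ∷ []) ⟩
      2 * (c * (e * e))                                                 ≤⟨ *-monoʳ-≤ 2 ce²≤ ⟩
      2 * (Δ * ((D + e) * (D + e)) + e * e)                             ≡⟨ solve (Δ ∷ D ∷ e ∷ []) ⟩
      2 * Δ * (D * D) + 4 * Δ * D * e + 2 * Δ * (e * e) + 2 * (e * e)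
        ≤⟨ +-monoˡ-≤ _ (+-monoˡ-≤ _ (+-mono-≤ 2ΔD²≤e³ (*-monoˡ-≤ e (*-monoʳ-≤ (4 * Δ) D≤Δ²)))) ⟩
      e * e * e + 4 * Δ * (Δ * Δ) * e + 2 * Δ * (e * e) + 2 * (e * e)  ≡⟨ solve (Δ ∷ e ∷ []) ⟩
      e * (e * e + 4 * (Δ * Δ * Δ) + 2 * Δ * e + 2 * e)                 ∎)
      where
      open ≤-Reasoning
      2ΔD²≤e³ : 2 * Δ * (D * D) ≤ e * e * e
      2ΔD²≤e³ = begin
        2 * Δ * (D * D)               ≤⟨ *-monoʳ-≤ (2 * Δ) (*-mono-≤ D≤Δ² D≤Δ²) ⟩
        2 * Δ * (Δ * Δ * (Δ * Δ))     ≡⟨ solve (Δ ∷ []) ⟩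
        2 * (Δ * Δ * Δ * Δ * Δ)       ≤⟨ <⇒≤ 2Δ⁵<e³ ⟩
        e * e * e                     ∎

    2el+4e≤ : 2 * e * (D + e + c) + 4 * e ≤ 2 * (Δ * Δ) * e + 3 * (e * e) + 4 * (Δ * Δ * Δ)
    2el+4e≤ = begin
      2 * e * (D + e + c) + 4 * e                                       ≡⟨ solve (e ∷ D ∷ c ∷ []) ⟩
      2 * (e * e) + 2 * c * e + 4 * e + 2 * e * D
        ≤⟨ +-monoˡ-≤ (2 * e * D) (+-monoˡ-≤ (4 * e) (+-monoʳ-≤ (2 * (e * e)) 2ce≤)) ⟩
      2 * (e * e) + (e * e + 4 * (Δ * Δ * Δ) + 2 * Δ * e + 2 * e) + 4 * e + 2 * e * D
                                                                        ≡⟨ solve (Δ ∷ D ∷ e ∷ []) ⟩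
      3 * (e * e) + 4 * (Δ * Δ * Δ) + 2 * e * (D + Δ + 3)              ≤⟨ +-monoʳ-≤ _ (*-monoʳ-≤ (2 * e) D+Δ+3≤Δ²) ⟩
      3 * (e * e) + 4 * (Δ * Δ * Δ) + 2 * e * (Δ * Δ)                  ≡⟨ solve (Δ ∷ e ∷ []) ⟩
      2 * (Δ * Δ) * e + 3 * (e * e) + 4 * (Δ * Δ * Δ)                  ∎
      where open ≤-Reasoning

  module _ (N M : ℕ) (q : Δ * (M * M * M) ≤ 2 * (N * N * N)) where

    private
      Δ²M≤eN : Δ * Δ * M ≤ e * N
      Δ²M≤eN = cube-cancel-≤ (begin
        Δ * Δ * M * (Δ * Δ * M) * (Δ * Δ * M)  ≡⟨ solve (Δ ∷ M ∷ []) ⟩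
        Δ * Δ * Δ * Δ * Δ * (Δ * (M * M * M))  ≤⟨ *-monoʳ-≤ (Δ * Δ * Δ * Δ * Δ) q ⟩
        Δ * Δ * Δ * Δ * Δ * (2 * (N * N * N))  ≡⟨ solve (Δ ∷ N ∷ []) ⟩
        2 * (Δ * Δ * Δ * Δ * Δ) * (N * N * N)  ≤⟨ *-monoˡ-≤ (N * N * N) (<⇒≤ 2Δ⁵<e³) ⟩
        e * e * e * (N * N * N)                ≡⟨ solve (e ∷ N ∷ []) ⟩
        e * N * (e * N) * (e * N)              ∎)
        where open ≤-Reasoning

      bM²≤2ΔN² : b * (M * M) ≤ 2 * Δ * (N * N)
      bM²≤2ΔN² = cube-cancel-≤ (begin
        b * (M * M) * (b * (M * M)) * (b * (M * M))            ≡⟨ solve (b ∷ M ∷ []) ⟩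
        b * b * b * ((M * M * M) * (M * M * M))                ≤⟨ *-monoˡ-≤ _ b³≤2Δ⁵ ⟩
        2 * (Δ * Δ * Δ * Δ * Δ) * ((M * M * M) * (M * M * M))  ≡⟨ solve (Δ ∷ M ∷ []) ⟩
        2 * (Δ * Δ * Δ) * (Δ * (M * M * M) * (Δ * (M * M * M))) ≤⟨ *-monoʳ-≤ (2 * (Δ * Δ * Δ)) (*-mono-≤ q q) ⟩
        2 * (Δ * Δ * Δ) * (2 * (N * N * N) * (2 * (N * N * N))) ≡⟨ solve (Δ ∷ N ∷ []) ⟩
        2 * Δ * (N * N) * (2 * Δ * (N * N)) * (2 * Δ * (N * N)) ∎)
        where open ≤-Reasoning

      mixed : (3 * (e * e) + 4 * (Δ * Δ * Δ)) * (M * M) ≤ 6 * e * Δ * (N * N) + 4 * e * Δ * N * M + 4 * e * (M * M)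
      mixed = begin
        (3 * (e * e) + 4 * (Δ * Δ * Δ)) * (M * M)                     ≡⟨ solve (Δ ∷ e ∷ M ∷ []) ⟩
        3 * e * (e * (M * M)) + 4 * Δ * M * (Δ * Δ * M)               ≡⟨ cong (λ x → 3 * e * (x * (M * M)) + 4 * Δ * M * (Δ * Δ * M)) e≡1+b ⟩
        3 * e * (M * M + b * (M * M)) + 4 * Δ * M * (Δ * Δ * M)
          ≤⟨ +-mono-≤ (*-monoʳ-≤ (3 * e) (+-monoʳ-≤ (M * M) bM²≤2ΔN²)) (*-monoʳ-≤ (4 * Δ * M) Δ²M≤eN) ⟩
        3 * e * (M * M + 2 * Δ * (N * N)) + 4 * Δ * M * (e * N)       ≤⟨ m≤m+n _ (e * (M * M)) ⟩
        3 * e * (M * M + 2 * Δ * (N * N)) + 4 * Δ * M * (e * N) + e * (M * M) ≡⟨ solve (Δ ∷ e ∷ N ∷ M ∷ []) ⟩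
        6 * e * Δ * (N * N) + 4 * e * Δ * N * M + 4 * e * (M * M)     ∎
        where open ≤-Reasoning

    BoundBy-large : (D + e + c) * (M * M) ≤ Δ * Δ * (M * M) + 3 * Δ * (N * N) + 2 * Δ * N * M
    BoundBy-large = *-cancelˡ-≤ (2 * e) {{>-nonZero (≤-trans e≥1 (m≤m+n e _))}} (+-cancelʳ-≤ (4 * e * (M * M)) _ _ (begin
      2 * e * ((D + e + c) * (M * M)) + 4 * e * (M * M)      ≡⟨ solve (e ∷ D ∷ c ∷ M ∷ []) ⟩
      (2 * e * (D + e + c) + 4 * e) * (M * M)                 ≤⟨ *-monoˡ-≤ (M * M) 2el+4e≤ ⟩
      (2 * (Δ * Δ) * e + 3 * (e * e) + 4 * (Δ * Δ * Δ)) * (M * M)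
                                                              ≡⟨ solve (Δ ∷ e ∷ M ∷ []) ⟩
      2 * (Δ * Δ) * e * (M * M) + (3 * (e * e) + 4 * (Δ * Δ * Δ)) * (M * M)
                                                              ≤⟨ +-monoʳ-≤ (2 * (Δ * Δ) * e * (M * M)) mixed ⟩
      2 * (Δ * Δ) * e * (M * M) + (6 * e * Δ * (N * N) + 4 * e * Δ * N * M + 4 * e * (M * M))
                                                              ≡⟨ solve (Δ ∷ e ∷ N ∷ M ∷ []) ⟩
      2 * e * (Δ * Δ * (M * M) + 3 * Δ * (N * N) + 2 * Δ * N * M) + 4 * e * (M * M) ∎))
      where open ≤-Reasoning

Parameters : ℕ → Set
Parameters Δ = ∃[ e ] ∃[ c ] 1 ≤ e × Δ * ((pred Δ * pred Δ + e) * (pred Δ * pred Δ + e)) ≤ c * (e * e)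
                              × BoundBy Δ (pred Δ * pred Δ + e + c)

-- For Δ ≥ 4 take e = ⌊(2Δ⁵)^(1/3)⌋ + 1 and c = ⌊Δβ²/e²⌋ + 1, where β = (Δ - 1)² + e.
parameters-large : ∀ δ → 3 ≤ δ → Parameters (suc δ)
parameters-large δ δ≥3 with root 3 (2 * (Δ * Δ * Δ * Δ * Δ))
  where Δ = suc δ
... | b , b³≤ , <e³ = e , c , s≤s z≤n , Δβ²≤ce² ,
      BoundBy-large Δ D b e c refl D+Δ+3≤Δ² (subst (_≤ 2 * (Δ * Δ * Δ * Δ * Δ)) (sym (cube≡^3 b)) b³≤)
        (subst (2 * (Δ * Δ * Δ * Δ * Δ) <_) (sym (cube≡^3 e)) <e³) ce²≤
  where
  Δ = suc δ
  D = δ * δ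
  e = suc b
  m = Δ * ((D + e) * (D + e))
  c = suc (m / (e * e))
  Δβ²≤ce² : m ≤ c * (e * e)
  Δβ²≤ce² = begin
    m                                   ≡⟨ m≡m%n+[m/n]*n m (e * e) ⟩
    m % (e * e) + m / (e * e) * (e * e) ≤⟨ +-monoˡ-≤ _ (<⇒≤ (m%n<n m (e * e))) ⟩
    e * e + m / (e * e) * (e * e)       ∎
    where open ≤-Reasoning
  ce²≤ : c * (e * e) ≤ m + e * e
  ce²≤ = ≤-trans (≤-reflexive (+-comm (e * e) _)) (+-monoˡ-≤ (e * e) (m/n*n≤m m (e * e)))
  D+Δ+3≤Δ² : D + Δ + 3 ≤ Δ * Δ
  D+Δ+3≤Δ² = begin
    δ * δ + suc δ + 3   ≡⟨ solve (δ ∷ []) ⟩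
    δ * δ + (δ + 4)     ≤⟨ +-monoʳ-≤ (δ * δ) (+-monoʳ-≤ δ (s≤s δ≥3)) ⟩
    δ * δ + (δ + suc δ) ≡⟨ solve (δ ∷ []) ⟩
    suc δ * suc δ       ∎
    where open ≤-Reasoning

parameters : ∀ Δ → 1 ≤ Δ → Parameters Δ
parameters 1 _ = 1 , 1 , ≤-refl , ≤-refl , BoundBy-ratio {1} {2} 2 M≤2N (≤ᵇ⇒≤ 8 11 _)
  where
  M≤2N : ∀ N M → 1 * (M * M * M) ≤ 2 * (N * N * N) → M ≤ 2 * N
  M≤2N N M q = cube-cancel-≤ (begin
    M * M * M                    ≡⟨ solve (M ∷ []) ⟩
    1 * (M * M * M)              ≤⟨ q ⟩
    2 * (N * N * N)              ≤⟨ *-monoˡ-≤ (N * N * N) (≤ᵇ⇒≤ 2 8 _) ⟩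
    8 * (N * N * N)              ≡⟨ solve (N ∷ []) ⟩
    2 * N * (2 * N) * (2 * N)    ∎)
    where open ≤-Reasoning
parameters 2 _ = 4 , 4 , s≤s z≤n , ≤ᵇ⇒≤ 50 64 _ , BoundBy-ratio {2} {9} 1 M≤N (≤ᵇ⇒≤ 9 14 _)
  where
  M≤N : ∀ N M → 2 * (M * M * M) ≤ 2 * (N * N * N) → M ≤ 1 * N
  M≤N N M q = subst (M ≤_) (sym (*-identityˡ N)) (cube-cancel-≤ (*-cancelˡ-≤ 2 q))
parameters 3 _ = 8 , 7 , s≤s z≤n , ≤ᵇ⇒≤ 432 448 _ , BoundBy-ratio {3} {19} 1 M≤N (≤ᵇ⇒≤ 19 24 _)
  where
  M≤N : ∀ N M → 3 * (M * M * M) ≤ 2 * (N * N * N) → M ≤ 1 * N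
  M≤N N M q = subst (M ≤_) (sym (*-identityˡ N))
                        (cube-cancel-≤ (*-cancelˡ-≤ 2 (≤-trans (*-monoˡ-≤ (M * M * M) (≤ᵇ⇒≤ 2 3 _)) q)))
parameters (suc (suc (suc (suc t)))) _ = parameters-large (3 + t) (s≤s (s≤s (s≤s z≤n)))

ι : ℕ → ℚᵘ
ι k = mkℚᵘ (ℤ.+ k) 0

BoundBy-cleared : ∀ {Δ l} → BoundBy Δ l → ∀ N M → Δ * (1 * (M * M * M)) ≤ 2 * (N * N * N) * 1 →
  l * (1 * (1 * (M * M)) * (1 * M))
  ≤ ((Δ * Δ * (1 * (M * M)) + 3 * Δ * (N * N) * 1) * (1 * M) + 2 * Δ * N * (1 * (1 * (M * M)))) * 1
BoundBy-cleared {Δ} {l} bound N M Δ≤2q³ = begin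
  l * (1 * (1 * (M * M)) * (1 * M))
    ≡⟨ solve (l ∷ M ∷ []) ⟩
  l * (M * M) * M
    ≤⟨ *-monoˡ-≤ M (bound N M Δ≤2q³′) ⟩
  (Δ * Δ * (M * M) + 3 * Δ * (N * N) + 2 * Δ * N * M) * M
    ≡⟨ solve (Δ ∷ N ∷ M ∷ []) ⟩
  ((Δ * Δ * (1 * (M * M)) + 3 * Δ * (N * N) * 1) * (1 * M) + 2 * Δ * N * (1 * (1 * (M * M)))) * 1 ∎
  where
  open ≤-Reasoning
  Δ≤2q³′ : Δ * (M * M * M) ≤ 2 * (N * N * N)
  Δ≤2q³′ = begin
    Δ * (M * M * M)        ≡⟨ solve (Δ ∷ M ∷ []) ⟩
    Δ * (1 * (M * M * M))  ≤⟨ Δ≤2q³ ⟩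
    2 * (N * N * N) * 1    ≡⟨ solve (N ∷ []) ⟩
    2 * (N * N * N)        ∎

-- For q = N / M with N, M > 0 every integer product and sum occurring below reduces to the
-- cast of the corresponding natural-number expression in BoundBy-cleared.
BoundBy⇒≤ᵘ : ∀ {Δ′ l} → BoundBy (suc Δ′) l → ∀ n m → let Δ = suc Δ′; q = mkℚᵘ (ℤ.+ suc n) m in
  ι Δ ≤ᵘ ι 2 *ᵘ (q *ᵘ q *ᵘ q) → ι l ≤ᵘ ι (Δ * Δ) +ᵘ ι (3 * Δ) *ᵘ (q *ᵘ q) +ᵘ ι (2 * Δ) *ᵘ q
BoundBy⇒≤ᵘ {l = zero}    _     n m _                  = *≤* (ℤ.+≤+ z≤n)
BoundBy⇒≤ᵘ {Δ′} {suc l′} bound n m (*≤* (ℤ.+≤+ Δ≤2q³)) =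
  *≤* (ℤ.+≤+ (BoundBy-cleared {suc Δ′} {suc l′} bound (suc n) (suc m) Δ≤2q³))

toℚᵘ-ℕtoℚ : ∀ k → toℚᵘ (ℕtoℚ k) ≃ ι k
toℚᵘ-ℕtoℚ k = toℚᵘ-fromℚᵘ (ι k)

module _ (q : ℚ) where

  private
    qᵘ = toℚᵘ q

  toℚᵘ-2q³ : toℚᵘ (ℕtoℚ 2 ℚ.* (q ℚ.* q ℚ.* q)) ≃ ι 2 *ᵘ (qᵘ *ᵘ qᵘ *ᵘ qᵘ)
  toℚᵘ-2q³ = ≃-trans (toℚᵘ-homo-* (ℕtoℚ 2) (q ℚ.* q ℚ.* q))
               (*-cong (toℚᵘ-ℕtoℚ 2) (≃-trans (toℚᵘ-homo-* (q ℚ.* q) q) (*-cong (toℚᵘ-homo-* q q) (≃-refl {qᵘ}))))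

  toℚᵘ-bound : ∀ a b c →
    toℚᵘ (ℕtoℚ a ℚ.+ ℕtoℚ b ℚ.* (q ℚ.* q) ℚ.+ ℕtoℚ c ℚ.* q) ≃ ι a +ᵘ ι b *ᵘ (qᵘ *ᵘ qᵘ) +ᵘ ι c *ᵘ qᵘ
  toℚᵘ-bound a b c =
    ≃-trans (toℚᵘ-homo-+ (ℕtoℚ a ℚ.+ ℕtoℚ b ℚ.* (q ℚ.* q)) (ℕtoℚ c ℚ.* q))
      (+-cong (≃-trans (toℚᵘ-homo-+ (ℕtoℚ a) (ℕtoℚ b ℚ.* (q ℚ.* q)))
                       (+-cong (toℚᵘ-ℕtoℚ a) (≃-trans (toℚᵘ-homo-* (ℕtoℚ b) (q ℚ.* q)) (*-cong (toℚᵘ-ℕtoℚ b) (toℚᵘ-homo-* q q)))))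
              (≃-trans (toℚᵘ-homo-* (ℕtoℚ c) q) (*-cong (toℚᵘ-ℕtoℚ c) (≃-refl {qᵘ}))))

BoundBy⇒BoundHolds : ∀ {Δ l} → 1 ≤ Δ → BoundBy Δ l → BoundHolds Δ l
BoundBy⇒BoundHolds {suc Δ′} {l} _ bound q Δ≤2q³ =
  toℚᵘ-cancel-≤ (≤-respˡ-≃ (≃-sym (toℚᵘ-ℕtoℚ l)) (≤-respʳ-≃ (≃-sym (toℚᵘ-bound q (Δ * Δ) (3 * Δ) (2 * Δ)))
    (in-ℚᵘ q (≤-respˡ-≃ (toℚᵘ-ℕtoℚ (suc Δ′)) (≤-respʳ-≃ (toℚᵘ-2q³ q) (toℚᵘ-mono-≤ Δ≤2q³))))))
  where
  Δ = suc Δ′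
  in-ℚᵘ : ∀ q → let qᵘ = toℚᵘ q in
    ι Δ ≤ᵘ ι 2 *ᵘ (qᵘ *ᵘ qᵘ *ᵘ qᵘ) → ι l ≤ᵘ ι (Δ * Δ) +ᵘ ι (3 * Δ) *ᵘ (qᵘ *ᵘ qᵘ) +ᵘ ι (2 * Δ) *ᵘ qᵘ
  in-ℚᵘ (mkℚ (ℤ.+ suc n) m _) Δ≤2q³ = BoundBy⇒≤ᵘ bound n m Δ≤2q³
  in-ℚᵘ (mkℚ (ℤ.+ zero)  _ _) (*≤* (ℤ.+≤+ ()))
  in-ℚᵘ (mkℚ ℤ.-[1+ _ ]  _ _) (*≤* ())

-- Imported only here: their overloaded constructors [] and _∷_ would make the variable
-- lists passed to the ring solver above ambiguous.
open import Data.List.Relation.Unary.All using (All; []; _∷_; all?)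
open import Data.List.Relation.Unary.Unique.Propositional using (Unique; []; _∷_)

sumMap-≤1 : (f : A → ℕ) (xs : List A) → Unique xs → (∀ x → f x ≤ 1) →
  (∀ {x y} → 0 < f x → 0 < f y → x ≡ y) → sumMap f xs ≤ 1
sumMap-≤1 f []       _              f≤1 f-once = z≤n
sumMap-≤1 f (x ∷ xs) u@(_ ∷ uxs) f≤1 f-once with f x in fx
... | zero  = sumMap-≤1 f xs uxs f≤1 f-once
... | suc _ = +-mono-≤ (subst (_≤ 1) fx (f≤1 x)) rest≤0
  where
  fx>0 : 0 < f x
  fx>0 = subst (0 <_) (sym fx) (s≤s z≤n)
  f≤0 : ∀ {y} → y ∈ xs → f y ≤ 0
  f≤0 {y} y∈ with f y in fy
  ... | zero  = z≤n
  ... | suc _ = contradiction (subst (_∈ xs) (sym (f-once fx>0 (subst (0 <_) (sym fy) (s≤s z≤n)))) y∈)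
                              (Unique[x∷xs]⇒x∉xs u)
  rest≤0 : sumMap f xs ≤ 0
  rest≤0 = ≤-trans (sumMap-mono f (λ _ → 0) xs f≤0) (≤-reflexive (sumMap-zero xs))

module _ (_≟_ : DecidableEquality A) where

  Unique-length-≤ : {xs ys : List A} → Unique xs → (∀ {x} → x ∈ xs → x ∈ ys) → length xs ≤ length ys
  Unique-length-≤ {[]}     _          _     = z≤n
  Unique-length-≤ {x ∷ xs} {ys} u@(_ ∷ uxs) xs⊆ys =
    ≤-trans (s≤s (Unique-length-≤ uxs xs⊆ys∖x)) (filter-notAll (¬? ∘ (x ≟_)) ys (Any.map (λ x≡y x≢y → x≢y x≡y) (xs⊆ys (here refl))))
    where
    xs⊆ys∖x : ∀ {y} → y ∈ xs → y ∈ filter (¬? ∘ (x ≟_)) ys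
    xs⊆ys∖x {y} y∈ = ∈-filter⁺ (¬? ∘ (x ≟_)) (xs⊆ys (there y∈)) (λ x≡y → Unique[x∷xs]⇒x∉xs u (subst (_∈ xs) (sym x≡y) y∈))

filter-filter : {P Q : Pred A 0ℓ} (P? : Decidable P) (Q? : Decidable Q) (xs : List A) →
  filter P? (filter Q? xs) ≡ filter (λ x → Q? x ×-dec P? x) xs
filter-filter P? Q? []       = refl
filter-filter P? Q? (x ∷ xs) with Q? x
... | no  _ = filter-filter P? Q? xs
... | yes _ with P? x
...   | yes _ = cong (x ∷_) (filter-filter P? Q? xs)
...   | no  _ = filter-filter P? Q? xs

Unique-++⁻ˡ : (xs : List A) {ys : List A} → Unique (xs ++ ys) → Unique xs
Unique-++⁻ˡ []       _          = []
Unique-++⁻ˡ (x ∷ xs) (x∉ ∷ uxs) = Allₚ.++⁻ˡ xs x∉ ∷ Unique-++⁻ˡ xs uxs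

Unique-++⁻ʳ : (xs : List A) {ys : List A} → Unique (xs ++ ys) → Unique ys
Unique-++⁻ʳ []       u         = u
Unique-++⁻ʳ (x ∷ xs) (_ ∷ uxs) = Unique-++⁻ʳ xs uxs

Unique-++-disjoint : (xs : List A) {ys : List A} → Unique (xs ++ ys) → ∀ {z} → z ∈ xs → z ∉ ys
Unique-++-disjoint (x ∷ xs) u (here refl) z∈ys = Unique[x∷xs]⇒x∉xs u (∈-++⁺ʳ xs z∈ys)
Unique-++-disjoint (x ∷ xs) (_ ∷ uxs) (there z∈xs) = Unique-++-disjoint xs uxs z∈xs

Unique-reverse : {xs : List A} → Unique xs → Unique (reverse xs)
Unique-reverse {xs = xs} = Unique-resp-↭ (↭-sym (↭-reverse xs))
  where
  open Permutation (setoid _)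
  open import Data.List.Relation.Binary.Permutation.Setoid (setoid _) using (↭-sym)

map-≡-∈ : {f g : A → B} {xs : List A} → map f xs ≡ map g xs → ∀ {x} → x ∈ xs → f x ≡ g x
map-≡-∈ {xs = y ∷ xs} eq (here refl) = ∷-injectiveˡ eq
map-≡-∈ {xs = y ∷ xs} eq (there x∈) = map-≡-∈ (∷-injectiveʳ eq) x∈

𝟙 : Dec A → ℕ
𝟙 (yes _) = 1
𝟙 (no  _) = 0

𝟙≤1 : (a : Dec A) → 𝟙 a ≤ 1
𝟙≤1 (yes _) = ≤-refl
𝟙≤1 (no  _) = z≤n

𝟙-pos : (a : Dec A) → 0 < 𝟙 a → A
𝟙-pos (yes p) _ = p

𝟙-yes : (a : Dec A) → A → 𝟙 a ≡ 1
𝟙-yes (yes _) _  = refl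
𝟙-yes (no ¬p) p = contradiction p ¬p

𝟙-no : (a : Dec A) → ¬ A → 𝟙 a ≡ 0
𝟙-no (yes p) ¬p = contradiction p ¬p
𝟙-no (no _)  _  = refl

𝟙-≤ : (a : Dec A) (b : Dec B) → (A → B) → 𝟙 a ≤ 𝟙 b
𝟙-≤ (yes p) (yes _) _   = ≤-refl
𝟙-≤ (yes p) (no ¬q) A→B = contradiction (A→B p) ¬q
𝟙-≤ (no _)  _       _   = z≤n

𝟙-split : (a : Dec A) (b : Dec B) → 𝟙 a ≤ 𝟙 b + 𝟙 (a ×-dec ¬? b)
𝟙-split (yes _) (yes _) = ≤-refl
𝟙-split (yes _) (no  _) = ≤-refl
𝟙-split (no  _) _       = z≤n

-- Non-backtracking walks and paths

module _ {n : ℕ} (G : Graph n) where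

  private
    V = Fin n
    Δ = maxDegree G
    d = pred Δ

  degree≤maxDegree : ∀ v → degree G v ≤ Δ
  degree≤maxDegree v = go (∈-allFin v)
    where
    go : ∀ {xs} → v ∈ xs → degree G v ≤ foldr (λ u m → degree G u ⊔ m) 0 xs
    go (here refl) = m≤m⊔n _ _
    go (there v∈)  = ≤-trans (go v∈) (m≤n⊔m _ _)

  neighbours : V → List V
  neighbours u = filter (λ x → T? (adj G u x)) (allFin n)

  ∈-neighbours⁻ : ∀ {u x} → x ∈ neighbours u → T (adj G u x)
  ∈-neighbours⁻ {u} x∈ = proj₂ (∈-filter⁻ (λ x → T? (adj G u x)) {xs = allFin n} x∈)

  ∈-neighbours⁺ : ∀ {u x} → T (adj G u x) → x ∈ neighbours u
  ∈-neighbours⁺ {u} {x} = ∈-filter⁺ (λ x → T? (adj G u x)) (∈-allFin x)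

  adj-sym : ∀ {u x} → T (adj G u x) → T (adj G x u)
  adj-sym {u} {x} = subst T (symmetric G u x)

  Consecutive-∷⁻ : ∀ {x xs} → Consecutive G (x ∷ xs) → Consecutive G xs
  Consecutive-∷⁻ {xs = []}    _        = tt
  Consecutive-∷⁻ {xs = _ ∷ _} (_ , cs) = cs

  Consecutive-++⁻ˡ : ∀ xs {ys} → Consecutive G (xs ++ ys) → Consecutive G xs
  Consecutive-++⁻ˡ []           _        = tt
  Consecutive-++⁻ˡ (x ∷ [])     _        = tt
  Consecutive-++⁻ˡ (x ∷ y ∷ xs) (a , cs) = a , Consecutive-++⁻ˡ (y ∷ xs) cs

  Consecutive-++⁻ʳ : ∀ xs {ys} → Consecutive G (xs ++ ys) → Consecutive G ys
  Consecutive-++⁻ʳ []       cs = cs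
  Consecutive-++⁻ʳ (x ∷ xs) cs = Consecutive-++⁻ʳ xs (Consecutive-∷⁻ cs)

  Consecutive-reverseAcc : ∀ {y} xs acc → Consecutive G (y ∷ xs) → Consecutive G (y ∷ acc) →
    Consecutive G (reverseAcc (y ∷ acc) xs)
  Consecutive-reverseAcc []       acc _        cs′ = cs′
  Consecutive-reverseAcc {y} (x ∷ xs) acc (a , cs) cs′ =
    Consecutive-reverseAcc xs (y ∷ acc) cs (adj-sym a , cs′)

  Consecutive-reverse : ∀ {xs} → Consecutive G xs → Consecutive G (reverse xs)
  Consecutive-reverse {[]}     _  = tt
  Consecutive-reverse {x ∷ xs} cs = Consecutive-reverseAcc xs [] cs tt

  Avoids : Maybe V → V → Set
  Avoids nothing  _ = ⊤
  Avoids (just p) x = p ≢ x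

  avoids? : ∀ p → Decidable (Avoids p)
  avoids? nothing  _ = yes tt
  avoids? (just p) x = ¬? (p ≟ x)

  firstSteps : Maybe V → V → List V
  firstSteps p u = filter (avoids? p) (neighbours u)

  -- The walks u x₁ … x_t (listed without u) that never immediately return to the previous
  -- vertex and whose first step avoids p.
  nbWalks : Maybe V → V → ℕ → List (List V)
  nbWalks p u zero    = [] ∷ []
  nbWalks p u (suc t) = concatMap (λ x → map (x ∷_) (nbWalks (just u) x t)) (firstSteps p u)

  ∈-nbWalks-suc⁺ : ∀ {p u t x W} → x ∈ firstSteps p u → W ∈ nbWalks (just u) x t → x ∷ W ∈ nbWalks p u (suc t)
  ∈-nbWalks-suc⁺ {u = u} {t} {x} x∈ W∈ =
    ∈-concatMap⁺′ (λ y → map (y ∷_) (nbWalks (just u) y t)) x∈ (∈-map⁺ (x ∷_) W∈)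

  ∈-nbWalks-suc⁻ : ∀ {p u t W} → W ∈ nbWalks p u (suc t) →
    ∃[ x ] ∃[ W′ ] W ≡ x ∷ W′ × x ∈ firstSteps p u × W′ ∈ nbWalks (just u) x t
  ∈-nbWalks-suc⁻ {p} {u} {t} W∈ with ∈-concatMap⁻′ (λ y → map (y ∷_) (nbWalks (just u) y t)) {firstSteps p u} W∈
  ... | x , x∈ , xW∈ with ∈-map⁻ (x ∷_) xW∈
  ...   | W′ , W′∈ , refl = x , W′ , refl , x∈ , W′∈

  ∈-firstSteps⁻ : ∀ {p u x} → x ∈ firstSteps p u → T (adj G u x)
  ∈-firstSteps⁻ {p} x∈ = ∈-neighbours⁻ (proj₁ (∈-filter⁻ (avoids? p) x∈))

  nbWalks-sound : ∀ {p u} t {W} → W ∈ nbWalks p u t → Consecutive G (u ∷ W) × length W ≡ t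
  nbWalks-sound zero    (here refl) = tt , refl
  nbWalks-sound {p} {u} (suc t) W∈ with ∈-nbWalks-suc⁻ {p} {u} {t} W∈
  ... | x , W , refl , x∈ , W∈′ with nbWalks-sound t W∈′
  ...   | cs , refl = (∈-firstSteps⁻ x∈ , cs) , refl

  nbWalks-complete : ∀ {p u W} → Unique (u ∷ W) → Consecutive G (u ∷ W) → All (Avoids p) W →
    W ∈ nbWalks p u (length W)
  nbWalks-complete {W = []}         _          _        _        = here refl
  nbWalks-complete {p} {u} {x ∷ W} (u∉ ∷ uxW) (a , cs) (px ∷ _) =
    ∈-nbWalks-suc⁺ {p} {u} {length W} (∈-filter⁺ (avoids? p) (∈-neighbours⁺ a) px) (nbWalks-complete uxW cs (All.tail u∉))

  private
    length-nbWalks-suc : ∀ q u t → (∀ {x} → T (adj G x u) → length (nbWalks (just u) x t) ≤ d ^ t) →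
      length (nbWalks q u (suc t)) ≤ length (firstSteps q u) * d ^ t
    length-nbWalks-suc q u t ih = begin
      length (nbWalks q u (suc t))
        ≡⟨ length-concatMap _ (firstSteps q u) ⟩
      sumMap (λ x → length (map (x ∷_) (nbWalks (just u) x t))) (firstSteps q u)
        ≤⟨ sumMap-≤-length* _ (d ^ t) _ bound ⟩
      length (firstSteps q u) * d ^ t ∎
      where
      open ≤-Reasoning
      bound : ∀ {x} → x ∈ firstSteps q u → length (map (x ∷_) (nbWalks (just u) x t)) ≤ d ^ t
      bound {x} x∈ = ≤-trans (≤-reflexive (length-map (x ∷_) (nbWalks (just u) x t))) (ih (adj-sym (∈-firstSteps⁻ x∈)))

  length-nbWalks-just : ∀ {p u} t → T (adj G u p) → length (nbWalks (just p) u t) ≤ d ^ t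
  length-nbWalks-just zero    _ = ≤-refl
  length-nbWalks-just {p} {u} (suc t) a =
    ≤-trans (length-nbWalks-suc (just p) u t (length-nbWalks-just t)) (*-monoˡ-≤ (d ^ t) fewer)
    where
    fewer : length (firstSteps (just p) u) ≤ d
    fewer = <⇒≤pred (<-≤-trans (filter-notAll (avoids? (just p)) (neighbours u)
                                   (Any.map (λ p≡x p≢x → p≢x p≡x) (∈-neighbours⁺ a)))
                                (degree≤maxDegree u))

  length-nbWalks-nothing : ∀ u t → length (nbWalks nothing u (suc t)) ≤ Δ * d ^ t
  length-nbWalks-nothing u t =
    ≤-trans (length-nbWalks-suc nothing u t (length-nbWalks-just t))
            (*-monoˡ-≤ (d ^ t) (≤-trans (length-filter (avoids? nothing) (neighbours u)) (degree≤maxDegree u)))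

  pathsFrom : V → List (List V)
  pathsFrom u = concatMap (λ t → map (u ∷_) (nbWalks nothing u t)) (upTo n)

  paths : List (List V)
  paths = concatMap pathsFrom (allFin n)

  paths-sound : ∀ {P} → P ∈ paths → Consecutive G P
  paths-sound P∈ with ∈-concatMap⁻′ pathsFrom {allFin n} P∈
  ... | u , _ , P∈′ with ∈-concatMap⁻′ (λ t → map (u ∷_) (nbWalks nothing u t)) {upTo n} P∈′
  ...   | t , _ , P∈″ with ∈-map⁻ (u ∷_) P∈″
  ...     | W , W∈ , refl = proj₁ (nbWalks-sound t W∈)

  Unique⇒length≤n : ∀ {P} → Unique P → length P ≤ n
  Unique⇒length≤n uP = ≤-trans (Unique-length-≤ _≟_ {ys = allFin n} uP (λ {x} _ → ∈-allFin x)) (≤-reflexive (length-tabulate id))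

  paths-complete : ∀ {u W} → Unique (u ∷ W) → Consecutive G (u ∷ W) → u ∷ W ∈ paths
  paths-complete {u} {W} uP cs =
    ∈-concatMap⁺′ pathsFrom (∈-allFin u)
      (∈-concatMap⁺′ (λ t → map (u ∷_) (nbWalks nothing u t)) (∈-upTo⁺ (Unique⇒length≤n uP))
        (∈-map⁺ (u ∷_) (nbWalks-complete uP cs (All.universal (λ _ → tt) W))))

  pathsAround : V → ℕ → ℕ → List (List V)
  pathsAround v j m = concatMap (λ B → map (λ F → reverse B ++ v ∷ F) (nbWalks (head B) v m)) (nbWalks nothing v j)

  -- Contains every path on 2k vertices having v among its first k vertices.
  halfPaths : V → ℕ → List (List V)
  halfPaths v k = concatMap (λ j → pathsAround v j (k + k ∸ suc j)) (upTo k)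

  length-pathsAround-zero : ∀ v m → length (pathsAround v 0 (suc m)) ≤ Δ * d ^ m
  length-pathsAround-zero v m = begin
    length (pathsAround v 0 (suc m))             ≡⟨ length-++ (map _ (nbWalks nothing v (suc m))) ⟩
    length (map _ (nbWalks nothing v (suc m))) + 0 ≡⟨ +-identityʳ _ ⟩
    length (map _ (nbWalks nothing v (suc m)))     ≡⟨ length-map _ (nbWalks nothing v (suc m)) ⟩
    length (nbWalks nothing v (suc m))             ≤⟨ length-nbWalks-nothing v m ⟩
    Δ * d ^ m                                      ∎
    where open ≤-Reasoning

  length-pathsAround-suc : ∀ v j m → length (pathsAround v (suc j) m) ≤ Δ * d ^ (j + m)
  length-pathsAround-suc v j m = begin
    length (pathsAround v (suc j) m)
      ≡⟨ length-concatMap _ (nbWalks nothing v (suc j)) ⟩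
    sumMap (λ B → length (map (λ F → reverse B ++ v ∷ F) (nbWalks (head B) v m))) (nbWalks nothing v (suc j))
      ≤⟨ sumMap-≤-length* _ (d ^ m) _ bound ⟩
    length (nbWalks nothing v (suc j)) * d ^ m
      ≤⟨ *-monoˡ-≤ (d ^ m) (length-nbWalks-nothing v j) ⟩
    Δ * d ^ j * d ^ m
      ≡⟨ *-assoc Δ (d ^ j) (d ^ m) ⟩
    Δ * (d ^ j * d ^ m)
      ≡⟨ cong (Δ *_) (^-distribˡ-+-* d j m) ⟨
    Δ * d ^ (j + m) ∎
    where
    open ≤-Reasoning
    bound : ∀ {B} → B ∈ nbWalks nothing v (suc j) → length (map (λ F → reverse B ++ v ∷ F) (nbWalks (head B) v m)) ≤ d ^ m
    bound B∈ with ∈-nbWalks-suc⁻ {nothing} {v} {j} B∈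
    ... | x , B′ , refl , x∈ , _ =
      ≤-trans (≤-reflexive (length-map _ (nbWalks (just x) v m))) (length-nbWalks-just m (∈-firstSteps⁻ x∈))

  length-halfPaths : ∀ v k → length (halfPaths v (suc k)) ≤ suc k * (Δ * d ^ (k + k))
  length-halfPaths v k = begin
    length (halfPaths v (suc k))              ≡⟨ length-concatMap (λ j → pathsAround v j (suc k + suc k ∸ suc j)) (upTo (suc k)) ⟩
    sumMap pathsAroundLength (upTo (suc k))   ≤⟨ sumMap-≤-length* pathsAroundLength (Δ * d ^ (k + k)) (upTo (suc k)) bound ⟩
    length (upTo (suc k)) * (Δ * d ^ (k + k)) ≡⟨ cong (_* (Δ * d ^ (k + k))) (length-upTo (suc k)) ⟩
    suc k * (Δ * d ^ (k + k))                 ∎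
    where
    open ≤-Reasoning
    pathsAroundLength : ℕ → ℕ
    pathsAroundLength j = length (pathsAround v j (suc k + suc k ∸ suc j))
    bound : ∀ {j} → j ∈ upTo (suc k) → pathsAroundLength j ≤ Δ * d ^ (k + k)
    bound {zero}  _  rewrite +-suc k k = length-pathsAround-zero v (k + k)
    bound {suc j} j∈ = subst (λ e → length (pathsAround v (suc j) (suc k + suc k ∸ suc (suc j))) ≤ Δ * d ^ e)
                             steps (length-pathsAround-suc v j _)
      where
      steps : j + (suc k + suc k ∸ suc (suc j)) ≡ k + k
      steps = begin-equality
        j + (k + suc k ∸ suc j) ≡⟨ cong (λ e → j + (e ∸ suc j)) (+-suc k k) ⟩
        j + (k + k ∸ j)         ≡⟨ m+[n∸m]≡n (≤-trans (n≤1+n j) (≤-trans (≤-pred (∈-upTo⁻ j∈)) (m≤m+n k k))) ⟩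
        k + k                   ∎

  private
    head-Avoids : ∀ xs {F} → (∀ {z} → z ∈ xs → z ∉ F) → All (Avoids (head xs)) F
    head-Avoids []       _    = All.universal (λ _ → tt) _
    head-Avoids (x ∷ xs) disj = Allₚ.¬Any⇒All¬ _ (disj (here refl))

  pathsAround-complete : ∀ {v} a F → Unique (a ++ v ∷ F) → Consecutive G (a ++ v ∷ F) →
    a ++ v ∷ F ∈ pathsAround v (length a) (length F)
  pathsAround-complete {v} a F uQ csQ =
    ∈-concatMap⁺′ (λ B → map (λ F → reverse B ++ v ∷ F) (nbWalks (head B) v (length F))) B∈
      (subst (_∈ map (λ F → reverse (reverse a) ++ v ∷ F) (nbWalks (head (reverse a)) v (length F)))
             (cong (_++ v ∷ F) (reverse-involutive a)) (∈-map⁺ _ F∈))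
    where
    Q≡ : a ++ v ∷ F ≡ (a ++ v ∷ []) ++ F
    Q≡ = sym (++-assoc a (v ∷ []) F)
    reverse-a∷v : reverse (a ++ v ∷ []) ≡ v ∷ reverse a
    reverse-a∷v = reverse-++ a (v ∷ [])
    B∈ : reverse a ∈ nbWalks nothing v (length a)
    B∈ = subst (λ t → reverse a ∈ nbWalks nothing v t) (length-reverse a)
           (nbWalks-complete
             (subst Unique reverse-a∷v (Unique-reverse (Unique-++⁻ˡ (a ++ v ∷ []) (subst Unique Q≡ uQ))))
             (subst (Consecutive G) reverse-a∷v (Consecutive-reverse (Consecutive-++⁻ˡ (a ++ v ∷ []) (subst (Consecutive G) Q≡ csQ))))
             (All.universal (λ _ → tt) (reverse a)))
    F∈ : F ∈ nbWalks (head (reverse a)) v (length F)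
    F∈ = nbWalks-complete (Unique-++⁻ʳ a uQ) (Consecutive-++⁻ʳ a csQ)
           (head-Avoids (reverse a) (λ z∈ z∈F → Unique-++-disjoint a uQ (reverse⁻ z∈) (there z∈F)))

  halfPaths-complete : ∀ {v k} a F → Unique (a ++ v ∷ F) → Consecutive G (a ++ v ∷ F) →
    length a < k → length a + suc (length F) ≡ k + k → a ++ v ∷ F ∈ halfPaths v k
  halfPaths-complete {v} {k} a F uQ csQ a<k len =
    ∈-concatMap⁺′ (λ j → pathsAround v j (k + k ∸ suc j)) (∈-upTo⁺ a<k)
      (subst (λ m → a ++ v ∷ F ∈ pathsAround v (length a) m) lengthF (pathsAround-complete a F uQ csQ))
    where
    lengthF : length F ≡ k + k ∸ suc (length a)
    lengthF = begin-equality
      length F                             ≡⟨ m+n∸m≡n (suc (length a)) (length F) ⟨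
      suc (length a) + length F ∸ suc (length a) ≡⟨ cong (_∸ suc (length a)) (+-suc (length a) (length F)) ⟨
      length a + suc (length F) ∸ suc (length a) ≡⟨ cong (_∸ suc (length a)) len ⟩
      k + k ∸ suc (length a)               ∎
      where open ≤-Reasoning

Square : ℕ → List A → Set
Square k s = length s ≡ k + k × take k s ≡ drop k s

IsSquare : List A → Set
IsSquare s = ∃[ k ] 0 < k × Square k s

square? : DecidableEquality A → ∀ k (s : List A) → Dec (Square k s)
square? _≟ᴬ_ k s = length s ℕ.≟ k + k ×-dec ≡-dec _≟ᴬ_ (take k s) (drop k s)

isSquare? : DecidableEquality A → (s : List A) → Dec (IsSquare s)
isSquare? _≟ᴬ_ s = map′ (λ (k , _ , sq) → k , sq) (λ (k , sq) → k , bound sq , sq)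
  (anyUpTo? (λ k → 0 <? k ×-dec square? _≟ᴬ_ k s) (suc (length s)))
  where
  bound : ∀ {k} → 0 < k × Square k s → k < suc (length s)
  bound {k} (_ , len , _) = s≤s (≤-trans (m≤m+n k k) (≤-reflexive (sym len)))

¬IsSquare[] : ¬ IsSquare {A} []
¬IsSquare[] (suc _ , _ , () , _)

take-length-++ : (xs : List A) {ys : List A} → take (length xs) (xs ++ ys) ≡ xs
take-length-++ []       = refl
take-length-++ (x ∷ xs) = cong (x ∷_) (take-length-++ xs)

drop-length-++ : (xs : List A) {ys : List A} → drop (length xs) (xs ++ ys) ≡ ys
drop-length-++ []       = refl
drop-length-++ (x ∷ xs) = drop-length-++ xs

Square-++ : (ys : List A) → Square (length ys) (ys ++ ys)
Square-++ ys = length-++ ys , trans (take-length-++ ys) (sym (drop-length-++ ys))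

Square⇒++ : ∀ {k} {s : List A} → Square k s → length (drop k s) ≡ k × s ≡ drop k s ++ drop k s
Square⇒++ {k = k} {s} (len , halves) =
  trans (length-drop k s) (trans (cong (_∸ k) len) (m+n∸n≡m k k)) ,
  trans (sym (take++drop≡id k s)) (cong (_++ drop k s) halves)

Square-reverse : ∀ {k} {s : List A} → Square k s → Square k (reverse s)
Square-reverse {k = k} {s} sq with Square⇒++ sq
... | len , s≡ = subst₂ Square (trans (length-reverse (drop k s)) len)
                   (sym (trans (cong reverse s≡) (reverse-++ (drop k s) (drop k s))))
                   (Square-++ (reverse (drop k s)))

IsSquare-++ : {ys : List A} → ys ≢ [] → IsSquare (ys ++ ys)
IsSquare-++ {ys = []}     ys≢[] = contradiction refl ys≢[]
IsSquare-++ {ys = y ∷ ys} _     = length (y ∷ ys) , s≤s z≤n , Square-++ (y ∷ ys)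

∈-take-++ : ∀ (xs : List A) {x ys k} → length xs < k → x ∈ take k (xs ++ x ∷ ys)
∈-take-++ []       {k = suc k} _              = here refl
∈-take-++ (_ ∷ xs) {k = suc k} (s≤s |xs|<k) = there (∈-take-++ xs |xs|<k)

map-++⁻ : {B : Set} (f : A → B) (xs : List A) {as bs : List B} → map f xs ≡ as ++ bs →
  ∃[ ys ] ∃[ zs ] xs ≡ ys ++ zs × map f ys ≡ as × map f zs ≡ bs
map-++⁻ f xs       {[]}     eq = [] , xs , refl , refl , eq
map-++⁻ f (x ∷ xs) {a ∷ as} eq with map-++⁻ f xs {as} (∷-injectiveʳ eq)
... | ys , zs , refl , ys↦as , zs↦bs = x ∷ ys , zs , refl , cong₂ _∷_ (∷-injectiveˡ eq) ys↦as , zs↦bs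

module _ {n : ℕ} (G : Graph n) where

  open import Data.List.Membership.DecPropositional (_≟_ {n}) using (_∈?_)
  open import Data.List.Relation.Unary.Unique.DecPropositional (_≟_ {n}) using (unique?)

  private
    V = Fin n

  Colouring : Set
  Colouring = Vec ℕ n

  PathIn : List V → List V → Set
  PathIn S P = Unique P × Consecutive G P × All (_∈ S) P

  SquarePathIn : List V → Colouring → Set
  SquarePathIn S w = ∃[ P ] PathIn S P × IsSquare (map (lookup w) P)

  squarePathIn? : ∀ S w → Dec (SquarePathIn S w)
  squarePathIn? S w = map′ fromAny toAny
    (any? (λ P → unique? P ×-dec all? (_∈? S) P ×-dec isSquare? ℕ._≟_ (map (lookup w) P)) (paths G))
    where
    Candidate : List V → Set
    Candidate P = Unique P × All (_∈ S) P × IsSquare (map (lookup w) P)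
    fromAny : Any Candidate (paths G) → SquarePathIn S w
    fromAny any with find any
    ... | P , P∈ , uP , P⊆S , sq = P , (uP , paths-sound G P∈ , P⊆S) , sq
    toAny : SquarePathIn S w → Any Candidate (paths G)
    toAny ([]    , _                , sq) = contradiction sq ¬IsSquare[]
    toAny (u ∷ W , (uP , csP , P⊆S) , sq) = lose (paths-complete G uP csP) (uP , P⊆S , sq)

  SquarePathIn-mono : ∀ {T S w} → (∀ {x} → x ∈ T → x ∈ S) → SquarePathIn T w → SquarePathIn S w
  SquarePathIn-mono T⊆S (P , (uP , csP , P⊆T) , sq) = P , (uP , csP , All.map T⊆S P⊆T) , sq

  SquarePathIn-cong : ∀ {S w w′} → (∀ {x} → x ∈ S → lookup w x ≡ lookup w′ x) →
    SquarePathIn S w → SquarePathIn S w′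
  SquarePathIn-cong {w = w} {w′} w≗w′ (P , pathP@(_ , _ , P⊆S) , sq) =
    P , pathP , subst IsSquare (map-cong-local (All.map w≗w′ P⊆S)) sq

  nonRepColoring : ∀ w → ¬ SquarePathIn (allFin n) w → NonRepColoring G (lookup w)
  nonRepColoring w sqFree p (_ , up , csp) as ys bs ys≢[] p↦ with map-++⁻ (lookup w) p {as} p↦
  ... | p₁ , p₂₃ , refl , _ , p₂₃↦ with map-++⁻ (lookup w) p₂₃ {ys ++ ys} (trans p₂₃↦ (sym (++-assoc ys ys bs)))
  ...   | p₂ , p₃ , refl , p₂↦ , _ =
    sqFree (p₂ , (Unique-++⁻ˡ p₂ (Unique-++⁻ʳ p₁ up) , Consecutive-++⁻ˡ G p₂ (Consecutive-++⁻ʳ G p₁ csp) ,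
                  All.universal ∈-allFin p₂)
               , subst IsSquare (sym p₂↦) (IsSquare-++ ys≢[]))

module _ {n : ℕ} (L : Fin n → List ℕ) where

  open import Data.List.Membership.DecPropositional (_≟_ {n}) using (_∈?_)

  private
    V   = Fin n
    Col = Vec ℕ n

  -- The sum of f over the colourings that agree with b off xs and take their colours on xs from L
  -- (each counted once when xs is duplicate-free).
  sumExt : List V → Col → (Col → ℕ) → ℕ
  sumExt []       b f = f b
  sumExt (x ∷ xs) b f = sumMap (λ a → sumExt xs (b [ x ]≔ a) f) (L x)

  record AgreeOff (xs : List V) (b w : Col) : Set where
    constructor agreeOff
    field agrees : ∀ {y} → y ∉ xs → lookup w y ≡ lookup b y
  open AgreeOff public

  sumExt-cong : ∀ xs b {f g} → (∀ w → f w ≡ g w) → sumExt xs b f ≡ sumExt xs b g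
  sumExt-cong []       b f≗g = f≗g b
  sumExt-cong (x ∷ xs) b f≗g = sumMap-cong (λ a → sumExt-cong xs (b [ x ]≔ a) f≗g) (L x)

  sumExt-+ : ∀ xs b f g → sumExt xs b (λ w → f w + g w) ≡ sumExt xs b f + sumExt xs b g
  sumExt-+ []       b f g = refl
  sumExt-+ (x ∷ xs) b f g =
    trans (sumMap-cong (λ a → sumExt-+ xs (b [ x ]≔ a) f g) (L x)) (sumMap-+ _ _ (L x))

  sumExt-*ˡ : ∀ xs b k f → sumExt xs b (λ w → k * f w) ≡ k * sumExt xs b f
  sumExt-*ˡ []       b k f = refl
  sumExt-*ˡ (x ∷ xs) b k f =
    trans (sumMap-cong (λ a → sumExt-*ˡ xs (b [ x ]≔ a) k f) (L x)) (sumMap-*ˡ k _ (L x))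

  sumExt-zero : ∀ xs b → sumExt xs b (λ _ → 0) ≡ 0
  sumExt-zero xs b = sumExt-*ˡ xs b 0 (λ _ → 0)

  sumExt-sumMap : {I : Set} (g : I → Col → ℕ) (is : List I) → ∀ xs b →
    sumExt xs b (λ w → sumMap (λ i → g i w) is) ≡ sumMap (λ i → sumExt xs b (g i)) is
  sumExt-sumMap g []       xs b = sumExt-zero xs b
  sumExt-sumMap g (i ∷ is) xs b =
    trans (sumExt-+ xs b (g i) _) (cong (sumExt xs b (g i) +_) (sumExt-sumMap g is xs b))

  private
    AgreeOff-∷ : ∀ {x xs b a w} → AgreeOff xs (b [ x ]≔ a) w → AgreeOff (x ∷ xs) b w
    AgreeOff-∷ {b = b} {a} ag = agreeOff λ y∉ →
      trans (agrees ag (y∉ ∘ there)) (lookup∘update′ (λ y≡x → y∉ (here y≡x)) b a)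

  sumExt-mono : ∀ xs b {f g} → (∀ w → AgreeOff xs b w → f w ≤ g w) → sumExt xs b f ≤ sumExt xs b g
  sumExt-mono []       b f≤g = f≤g b (agreeOff λ _ → refl)
  sumExt-mono (x ∷ xs) b f≤g =
    sumMap-mono _ _ (L x) (λ {a} _ → sumExt-mono xs (b [ x ]≔ a) (λ w → f≤g w ∘ AgreeOff-∷))

  sumExt-pos : ∀ xs b f → 0 < sumExt xs b f →
    ∃[ w ] AgreeOff xs b w × (∀ {y} → y ∈ xs → lookup w y ∈ L y) × 0 < f w
  sumExt-pos []       b f pos = b , agreeOff (λ _ → refl) , (λ ()) , pos
  sumExt-pos (x ∷ xs) b f pos with sumMap-pos _ (L x) pos
  ... | a , a∈ , pos′ with sumExt-pos xs (b [ x ]≔ a) f pos′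
  ...   | w , agree , coloured , fw>0 = w , AgreeOff-∷ agree , coloured′ , fw>0
    where
    coloured′ : ∀ {y} → y ∈ x ∷ xs → lookup w y ∈ L y
    coloured′ (there y∈) = coloured y∈
    coloured′ (here refl) with x ∈? xs
    ... | yes x∈ = coloured x∈
    ... | no  x∉ = subst (_∈ L x) (sym (trans (agrees agree x∉) (lookup∘update x b a))) a∈

  sumExt-≤1 : ∀ xs b f → Unique xs → (∀ y → Unique (L y)) → (∀ w → f w ≤ 1) →
    (∀ {w w′} → AgreeOff xs b w → AgreeOff xs b w′ → 0 < f w → 0 < f w′ → ∀ {y} → y ∈ xs → lookup w y ≡ lookup w′ y) →
    sumExt xs b f ≤ 1
  sumExt-≤1 []       b f _          _  f≤1 _      = f≤1 b
  sumExt-≤1 (x ∷ xs) b f u@(_ ∷ uxs) uL f≤1 unique =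
    sumMap-≤1 _ (L x) (uL x)
      (λ a → sumExt-≤1 xs (b [ x ]≔ a) f uxs uL f≤1 (λ ag ag′ p p′ → unique (AgreeOff-∷ ag) (AgreeOff-∷ ag′) p p′ ∘ there))
      same
    where
    same : ∀ {a a′} → 0 < sumExt xs (b [ x ]≔ a) f → 0 < sumExt xs (b [ x ]≔ a′) f → a ≡ a′
    same {a} {a′} p p′ with sumExt-pos xs _ f p | sumExt-pos xs _ f p′
    ... | w , ag , _ , fw>0 | w′ , ag′ , _ , fw′>0 = begin
      a                      ≡⟨ lookup∘update x b a ⟨
      lookup (b [ x ]≔ a) x  ≡⟨ agrees ag (Unique[x∷xs]⇒x∉xs u) ⟨
      lookup w x             ≡⟨ unique (AgreeOff-∷ ag) (AgreeOff-∷ ag′) fw>0 fw′>0 (here refl) ⟩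
      lookup w′ x            ≡⟨ agrees ag′ (Unique[x∷xs]⇒x∉xs u) ⟩
      lookup (b [ x ]≔ a′) x ≡⟨ lookup∘update x b a′ ⟩
      a′                     ∎
      where open ≡-Reasoning

  sumExt-∷ : ∀ {x} xs b f → x ∉ xs → sumExt (x ∷ xs) b f ≡ sumExt xs b (λ u → sumExt (x ∷ []) u f)
  sumExt-∷         []       b f _  = refl
  sumExt-∷ {x} (y ∷ xs) b f x∉ = begin
    sumMap (λ a → sumMap (λ c → sumExt xs ((b [ x ]≔ a) [ y ]≔ c) f) (L y)) (L x)
      ≡⟨ sumMap-cong (λ a → sumMap-cong (λ c → cong (λ u → sumExt xs u f) ([]≔-commutes b x y x≢y)) (L y)) (L x) ⟩
    sumMap (λ a → sumMap (λ c → sumExt xs ((b [ y ]≔ c) [ x ]≔ a) f) (L y)) (L x)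
      ≡⟨ sumMap-comm (λ a c → sumExt xs ((b [ y ]≔ c) [ x ]≔ a) f) (L x) (L y) ⟩
    sumMap (λ c → sumMap (λ a → sumExt xs ((b [ y ]≔ c) [ x ]≔ a) f) (L x)) (L y)
      ≡⟨ sumMap-cong (λ c → sumExt-∷ xs (b [ y ]≔ c) f (x∉ ∘ there)) (L y) ⟩
    sumMap (λ c → sumExt xs (b [ y ]≔ c) (λ u → sumExt (x ∷ []) u f)) (L y) ∎
    where
    open ≡-Reasoning
    x≢y : x ≢ y
    x≢y x≡y = x∉ (here x≡y)

  sumExt-partition : {P : Pred V 0ℓ} (P? : Decidable P) → ∀ S b f → Unique S →
    sumExt S b f ≡ sumExt (filter (¬? ∘ P?) S) b (λ u → sumExt (filter P? S) u f)
  sumExt-partition P? []      b f _ = refl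
  sumExt-partition P? (x ∷ S) b f u@(_ ∷ uS) with P? x
  ... | no  _ = sumMap-cong (λ a → sumExt-partition P? S (b [ x ]≔ a) f uS) (L x)
  ... | yes _ = trans (sumMap-cong (λ a → sumExt-partition P? S (b [ x ]≔ a) f uS) (L x))
                      (sumExt-∷ (filter (¬? ∘ P?) S) b _ (Unique[x∷xs]⇒x∉xs u ∘ proj₁ ∘ ∈-filter⁻ (¬? ∘ P?)))

-- The counting argument

module _ {n : ℕ} (G : Graph n) where

  open import Data.List.Membership.DecPropositional (_≟_ {n}) using (_∈?_; _∉?_)
  open import Data.List.Relation.Unary.Unique.DecPropositional (_≟_ {n}) using (unique?)

  private
    V = Fin n
    Δ = maxDegree G

  infixl 5 _∖_

  _∖_ : List V → List V → List V
  S ∖ H = filter (_∉? H) S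

  ∈-∖⁺ : ∀ {x S H} → x ∈ S → x ∉ H → x ∈ S ∖ H
  ∈-∖⁺ {H = H} = ∈-filter⁺ (_∉? H)

  ∈-∖⁻ : ∀ {x S H} → x ∈ S ∖ H → x ∈ S × x ∉ H
  ∈-∖⁻ {H = H} = ∈-filter⁻ (_∉? H)

  Unique-∖ : ∀ {S} H → Unique S → Unique (S ∖ H)
  Unique-∖ H = filter⁺ (_∉? H)

  ∖-∖ : ∀ S A B → S ∖ A ∖ B ≡ S ∖ (A ++ B)
  ∖-∖ S A B = trans (filter-filter (_∉? B) (_∉? A) S) (filter-≐ _ (_∉? (A ++ B)) (to , from) S)
    where
    to : ∀ {y} → y ∉ A × y ∉ B → y ∉ A ++ B
    to (y∉A , y∉B) y∈ = [ y∉A , y∉B ]′ (∈-++⁻ A y∈)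
    from : ∀ {y} → y ∉ A ++ B → y ∉ A × y ∉ B
    from y∉ = y∉ ∘ ∈-++⁺ˡ , y∉ ∘ ∈-++⁺ʳ A

  ∖-cong : ∀ S {C D} → (∀ {y} → y ∈ C → y ∈ D) → (∀ {y} → y ∈ D → y ∈ C) → S ∖ C ≡ S ∖ D
  ∖-cong S {C} {D} C⊆D D⊆C = filter-≐ (_∉? C) (_∉? D) ((λ y∉C → y∉C ∘ D⊆C) , (λ y∉D → y∉D ∘ C⊆D)) S

  ∉⇒∖-id : ∀ {x S} → x ∉ S → S ∖ [ x ] ≡ S
  ∉⇒∖-id {x} x∉S = filter-all (_∉? [ x ]) (All.tabulate λ { y∈S (here refl) → x∉S y∈S })

  length-∖-∈ : ∀ {S v} → Unique S → v ∈ S → length S ≡ suc (length (S ∖ [ v ]))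
  length-∖-∈ {x ∷ S} u (here refl) =
    cong (suc ∘ length) (sym (trans (filter-reject (_∉? [ x ]) {x} {S} (λ x∉ → x∉ (here refl))) (∉⇒∖-id (Unique[x∷xs]⇒x∉xs u))))
  length-∖-∈ {x ∷ S} {v} u@(_ ∷ uS) (there v∈S) = begin
    suc (length S)                 ≡⟨ cong suc (length-∖-∈ uS v∈S) ⟩
    suc (length (x ∷ (S ∖ [ v ]))) ≡⟨ cong (suc ∘ length) (filter-accept (_∉? [ v ]) {x} {S} λ { (here refl) → Unique[x∷xs]⇒x∉xs u v∈S }) ⟨
    suc (length ((x ∷ S) ∖ [ v ])) ∎
    where open ≡-Reasoning

  ∩-singleton : ∀ {v S} → Unique S → v ∈ S → filter (_∈? [ v ]) S ≡ [ v ]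
  ∩-singleton {v} {x ∷ S} u (here refl) =
    trans (filter-accept (_∈? [ v ]) {v} {S} (here refl))
          (cong (v ∷_) (filter-none (_∈? [ v ]) (All.tabulate λ { y∈S (here refl) → Unique[x∷xs]⇒x∉xs u y∈S })))
  ∩-singleton {v} {x ∷ S} u@(_ ∷ uS) (there v∈S) =
    trans (filter-reject (_∈? [ v ]) {x} {S} λ { (here refl) → Unique[x∷xs]⇒x∉xs u v∈S }) (∩-singleton uS v∈S)

  module _ (L : Fin n → List ℕ) (uL : ∀ x → Unique (L x)) where

    private
      z : Colouring G
      z = replicate n 0

    SquareFree : List V → Colouring G → Set
    SquareFree S w = ¬ SquarePathIn G S w

    opaque
      squareFree? : ∀ S w → Dec (SquareFree S w)
      squareFree? S w = ¬? (squarePathIn? G S w)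

    good : List V → ℕ
    good S = sumExt L S z (𝟙 ∘ squareFree? S)

    good[]≡1 : good [] ≡ 1
    good[]≡1 = 𝟙-yes (squareFree? [] z) λ { (P , (_ , _ , P⊆[]) , sq) → ¬IsSquare[] (subst (IsSquare ∘ map (lookup z)) (empty P⊆[]) sq) }
      where
      empty : ∀ {P : List V} → All (_∈ []) P → P ≡ []
      empty []      = refl

    good-chain : ∀ β m → (∀ {S v} → length S ≤ m → Unique S → v ∈ S → β * good (S ∖ [ v ]) ≤ good S) →
      ∀ U {S} → Unique U → Unique S → All (_∈ S) U → length S ≤ m → β ^ length U * good (S ∖ U) ≤ good S
    good-chain β m step []      {S} _           _  _            _   =
      ≤-reflexive (trans (+-identityʳ _) (cong good (filter-all (_∉? []) (All.universal (λ _ ()) S))))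
    good-chain β m step (x ∷ U) {S} u@(_ ∷ uU) uS (x∈S ∷ U⊆S) |S|≤m = begin
      β * β ^ length U * good (S ∖ (x ∷ U))
        ≡⟨ cong (λ T → β * β ^ length U * good T) (trans (∖-∖ S U [ x ]) (∖-cong S (swap {A = U}) (swap {A = [ x ]}))) ⟨
      β * β ^ length U * good (S ∖ U ∖ [ x ])
        ≡⟨ xy∙z≈y∙xz β (β ^ length U) _ ⟩
      β ^ length U * (β * good (S ∖ U ∖ [ x ]))
        ≤⟨ *-monoʳ-≤ (β ^ length U) (step (≤-trans (length-filter (_∉? U) S) |S|≤m) (Unique-∖ U uS) x∈S∖U) ⟩
      β ^ length U * good (S ∖ U)
        ≤⟨ good-chain β m step U uU uS U⊆S |S|≤m ⟩
      good S ∎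
      where
      open ≤-Reasoning
      x∈S∖U : x ∈ S ∖ U
      x∈S∖U = ∈-∖⁺ x∈S (Unique[x∷xs]⇒x∉xs u)
      swap : ∀ {y A B} → y ∈ A ++ B → y ∈ B ++ A
      swap {A = A} {B} y∈ = [ ∈-++⁺ʳ B , ∈-++⁺ˡ ]′ (∈-++⁻ A y∈)

    module _ {S : List V} {v : V} (uS : Unique S) (v∈S : v ∈ S) where

      private
        R = S ∖ [ v ]

      NewSquare : Colouring G → Set
      NewSquare w = SquareFree R w × ¬ SquareFree S w

      newSquare? : ∀ w → Dec (NewSquare w)
      newSquare? w = squareFree? R w ×-dec ¬? (squareFree? S w)

      good-split : length (L v) * good R ≤ good S + sumExt L S z (𝟙 ∘ newSquare?)
      good-split = begin
        length (L v) * good R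
          ≡⟨ sumExt-*ˡ L R z (length (L v)) _ ⟨
        sumExt L R z (λ u → length (L v) * 𝟙 (squareFree? R u))
          ≤⟨ sumExt-mono L R z (λ u _ → pointwise u) ⟩
        sumExt L R z (λ u → sumExt L [ v ] u (λ w → 𝟙 (squareFree? S w) + 𝟙 (newSquare? w)))
          ≡⟨ sumExt-cong L R z (λ u → sumMap-+ _ _ (L v)) ⟩
        sumExt L R z (λ u → sumExt L [ v ] u (𝟙 ∘ squareFree? S) + sumExt L [ v ] u (𝟙 ∘ newSquare?))
          ≡⟨ sumExt-+ L R z _ _ ⟩
        sumExt L R z (λ u → sumExt L [ v ] u (𝟙 ∘ squareFree? S)) + sumExt L R z (λ u → sumExt L [ v ] u (𝟙 ∘ newSquare?))
          ≡⟨ cong₂ _+_ (remove-v (𝟙 ∘ squareFree? S)) (remove-v (𝟙 ∘ newSquare?)) ⟨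
        good S + sumExt L S z (𝟙 ∘ newSquare?) ∎
        where
        open ≤-Reasoning
        remove-v : ∀ f → sumExt L S z f ≡ sumExt L R z (λ u → sumExt L [ v ] u f)
        remove-v f = trans (sumExt-partition L (_∈? [ v ]) S z f uS)
                           (cong (λ T → sumExt L R z (λ u → sumExt L T u f)) (∩-singleton uS v∈S))
        v∉R : v ∉ R
        v∉R v∈R = proj₂ (∈-∖⁻ {S = S} {[ v ]} v∈R) (here refl)
        unchanged : ∀ u a → SquarePathIn G R (u [ v ]≔ a) → SquarePathIn G R u
        unchanged u a = SquarePathIn-cong G {R} {u [ v ]≔ a} {u} (λ {x} x∈R → lookup∘update′ (λ x≡v → v∉R (subst (_∈ R) x≡v x∈R)) u a)
        pointwise : ∀ u → length (L v) * 𝟙 (squareFree? R u)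
                          ≤ sumMap (λ a → 𝟙 (squareFree? S (u [ v ]≔ a)) + 𝟙 (newSquare? (u [ v ]≔ a))) (L v)
        pointwise u = begin
          length (L v) * 𝟙 (squareFree? R u) ≡⟨ sumMap-const _ (L v) ⟨
          sumMap (λ _ → 𝟙 (squareFree? R u)) (L v)
            ≤⟨ sumMap-mono _ _ (L v) (λ {a} _ → ≤-trans (𝟙-≤ (squareFree? R u) (squareFree? R (u [ v ]≔ a)) (λ sf → sf ∘ unchanged u a))
                                                        (𝟙-split (squareFree? R (u [ v ]≔ a)) (squareFree? S (u [ v ]≔ a)))) ⟩
          sumMap (λ a → 𝟙 (squareFree? S (u [ v ]≔ a)) + 𝟙 (newSquare? (u [ v ]≔ a))) (L v) ∎

      HalfPath : ℕ → List V → Set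
      HalfPath k Q = Unique Q × All (_∈ S) Q × v ∈ take k Q × length Q ≡ k + k

      opaque
        halfPath? : ∀ k Q → Dec (HalfPath k Q)
        halfPath? k Q = unique? Q ×-dec all? (_∈? S) Q ×-dec v ∈? take k Q ×-dec length Q ℕ.≟ k + k

      SquareThrough : ℕ → List V → Colouring G → Set
      SquareThrough k Q w = HalfPath k Q × map (lookup w) (take k Q) ≡ map (lookup w) (drop k Q) × SquareFree R w

      opaque
        squareThrough? : ∀ k Q w → Dec (SquareThrough k Q w)
        squareThrough? k Q w =
          halfPath? k Q ×-dec ≡-dec ℕ._≟_ (map (lookup w) (take k Q)) (map (lookup w) (drop k Q)) ×-dec squareFree? R w

      private
        squareThrough-around : ∀ {k w} a F → Unique (a ++ v ∷ F) → Consecutive G (a ++ v ∷ F) → All (_∈ S) (a ++ v ∷ F) →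
          Square k (map (lookup w) (a ++ v ∷ F)) → length a < k → SquareFree R w →
          a ++ v ∷ F ∈ halfPaths G v k × SquareThrough k (a ++ v ∷ F) w
        squareThrough-around {k} {w} a F uQ csQ Q⊆S (len , halves) a<k sfR =
          halfPaths-complete G a F uQ csQ a<k (trans (sym (length-++ a)) lenQ) ,
          (uQ , Q⊆S , ∈-take-++ a a<k , lenQ) , trans (sym (take-map k (a ++ v ∷ F))) (trans halves (drop-map k (a ++ v ∷ F))) , sfR
          where
          lenQ : length (a ++ v ∷ F) ≡ k + k
          lenQ = trans (sym (length-map (lookup w) (a ++ v ∷ F))) len

        reverse-around : ∀ (a F : List V) → reverse (a ++ v ∷ F) ≡ reverse F ++ v ∷ reverse a
        reverse-around a F = begin
          reverse (a ++ v ∷ F)               ≡⟨ reverse-++ a (v ∷ F) ⟩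
          reverse (v ∷ F) ++ reverse a       ≡⟨ cong (_++ reverse a) (unfold-reverse v F) ⟩
          (reverse F ++ v ∷ []) ++ reverse a ≡⟨ ++-assoc (reverse F) (v ∷ []) (reverse a) ⟩
          reverse F ++ v ∷ reverse a         ∎
          where open ≡-Reasoning

      newSquare⇒squareThrough : ∀ {w} → NewSquare w →
        ∃[ k ] k < n × ∃[ Q ] Q ∈ halfPaths G v (suc k) × SquareThrough (suc k) Q w
      newSquare⇒squareThrough {w} (sfR , ¬sfS) with decidable-stable (squarePathIn? G S w) ¬sfS
      ... | P , (uP , csP , P⊆S) , suc k , _ , sq with v ∈? P
      ...   | no v∉P = contradiction (P , (uP , csP , P⊆R) , suc k , s≤s z≤n , sq) sfR
        where
        P⊆R : All (_∈ R) P
        P⊆R = All.tabulate λ x∈P → ∈-∖⁺ (All.lookup P⊆S x∈P) λ { (here refl) → v∉P x∈P }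
      ...   | yes v∈P with ∈-∃++ v∈P
      ...     | a , F , refl = k , k<n , around (length a <? suc k)
        where
        lenP : length a + suc (length F) ≡ suc k + suc k
        lenP = trans (sym (length-++ a)) (trans (sym (length-map (lookup w) (a ++ v ∷ F))) (proj₁ sq))
        k<n : k < n
        k<n = ≤-trans (m≤m+n (suc k) (suc k)) (≤-trans (≤-reflexive (trans (sym lenP) (sym (length-++ a)))) (Unique⇒length≤n G uP))
        around : Dec (length a < suc k) → ∃[ Q ] Q ∈ halfPaths G v (suc k) × SquareThrough (suc k) Q w
        around (yes a<k) = a ++ v ∷ F , squareThrough-around {suc k} {w} a F uP csP P⊆S sq a<k sfR
        around (no  a≮k) = reverse F ++ v ∷ reverse a ,
          squareThrough-around {suc k} {w} (reverse F) (reverse a)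
            (subst Unique rev (Unique-reverse uP)) (subst (Consecutive G) rev (Consecutive-reverse G csP))
            (subst (All (_∈ S)) rev (All.tabulate (All.lookup P⊆S ∘ reverse⁻)))
            (subst (Square (suc k)) (trans (sym (reverse-map (lookup w) (a ++ v ∷ F))) (cong (map (lookup w)) rev)) (Square-reverse sq))
            (subst (_< suc k) (sym (length-reverse F)) F<k) sfR
          where
          rev : reverse (a ++ v ∷ F) ≡ reverse F ++ v ∷ reverse a
          rev = reverse-around a F
          F<k : length F < suc k
          F<k = +-cancelˡ-≤ (suc k) _ _ (≤-trans (+-monoˡ-≤ (suc (length F)) (≮⇒≥ a≮k)) (≤-reflexive lenP))

      -- Once the colours off the first half H₁ of Q are fixed, the square forces the colours on H₁
      -- (they repeat those on the second half), and S ∖ H₁ must already be square-free.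
      squareThrough≤good-∖ : ∀ {k Q} → HalfPath k Q → sumExt L S z (𝟙 ∘ squareThrough? k Q) ≤ good (S ∖ take k Q)
      squareThrough≤good-∖ {k} {Q} (uQ , Q⊆S , v∈H₁ , _) = begin
        sumExt L S z count                             ≡⟨ sumExt-partition L (_∈? H₁) S z count uS ⟩
        sumExt L S∖H₁ z (λ u → sumExt L S∩H₁ u count) ≤⟨ sumExt-mono L S∖H₁ z (λ u _ → at-most-one u (squareFree? S∖H₁ u)) ⟩
        sumExt L S∖H₁ z (𝟙 ∘ squareFree? S∖H₁)        ∎
        where
        open ≤-Reasoning
        H₁ = take k Q
        H₂ = drop k Q
        S∖H₁ = S ∖ H₁
        S∩H₁ = filter (_∈? H₁) S
        count = 𝟙 ∘ squareThrough? k Q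
        uH₁H₂ : Unique (H₁ ++ H₂)
        uH₁H₂ = subst Unique (sym (take++drop≡id k Q)) uQ
        ∉S∩H₁ : ∀ {x} → x ∉ H₁ → x ∉ S∩H₁
        ∉S∩H₁ x∉H₁ = x∉H₁ ∘ proj₂ ∘ ∈-filter⁻ (_∈? H₁) {xs = S}
        S∖H₁⊆R : ∀ {x} → x ∈ S∖H₁ → x ∈ R
        S∖H₁⊆R x∈S∖H₁ with ∈-∖⁻ {S = S} {H₁} x∈S∖H₁
        ... | x∈S , x∉H₁ = ∈-∖⁺ x∈S λ { (here refl) → x∉H₁ v∈H₁ }
        at-most-one : ∀ u → (sf : Dec (SquareFree S∖H₁ u)) → sumExt L S∩H₁ u count ≤ 𝟙 sf
        at-most-one u (no ¬sf) = begin
          sumExt L S∩H₁ u count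
            ≤⟨ sumExt-mono L S∩H₁ u (λ w ag → ≤-reflexive (𝟙-no (squareThrough? k Q w) (λ (_ , _ , sfR) → sfR (squareR w ag)))) ⟩
          sumExt L S∩H₁ u (λ _ → 0)
            ≡⟨ sumExt-zero L S∩H₁ u ⟩
          0 ∎
          where
          squareR : ∀ w → AgreeOff L S∩H₁ u w → SquarePathIn G R w
          squareR w ag = SquarePathIn-mono G {S∖H₁} {R} {w} S∖H₁⊆R
            (SquarePathIn-cong G {S∖H₁} {u} {w} (λ x∈S∖H₁ → sym (agrees ag (∉S∩H₁ (proj₂ (∈-∖⁻ {S = S} {H₁} x∈S∖H₁)))))
                                              (decidable-stable (squarePathIn? G S∖H₁ u) ¬sf))
        at-most-one u (yes _) =
          sumExt-≤1 L S∩H₁ u count (filter⁺ (_∈? H₁) uS) uL (𝟙≤1 ∘ squareThrough? k Q) same-on-H₁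
          where
          on-H₂ : ∀ {w} → AgreeOff L S∩H₁ u w → map (lookup w) H₂ ≡ map (lookup u) H₂
          on-H₂ ag = map-cong-local (All.tabulate λ x∈H₂ → agrees ag (∉S∩H₁ λ x∈H₁ → Unique-++-disjoint H₁ uH₁H₂ x∈H₁ x∈H₂))
          same-on-H₁ : ∀ {w w′} → AgreeOff L S∩H₁ u w → AgreeOff L S∩H₁ u w′ → 0 < count w → 0 < count w′ →
            ∀ {y} → y ∈ S∩H₁ → lookup w y ≡ lookup w′ y
          same-on-H₁ {w} {w′} ag ag′ cw>0 cw′>0 y∈ =
            map-≡-∈ (trans (proj₁ (proj₂ (𝟙-pos (squareThrough? k Q w) cw>0)))
                    (trans (on-H₂ ag) (trans (sym (on-H₂ ag′)) (sym (proj₁ (proj₂ (𝟙-pos (squareThrough? k Q w′) cw′>0)))))))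
                    (proj₂ (∈-filter⁻ (_∈? H₁) {xs = S} y∈))

      module _ (β : ℕ) (chainR : ∀ U → Unique U → All (_∈ R) U → β ^ length U * good (R ∖ U) ≤ good R) where

        good-∖-half≤ : ∀ {k Q} → HalfPath (suc k) Q → β ^ k * good (S ∖ take (suc k) Q) ≤ good R
        good-∖-half≤ {k} {Q} (uQ , Q⊆S , v∈H₁ , lenQ) = begin
          β ^ k * good (S ∖ H₁)        ≡⟨ cong₂ (λ i T → β ^ i * good T) (sym |U|≡k) (sym R∖U≡S∖H₁) ⟩
          β ^ length U * good (R ∖ U)  ≤⟨ chainR U (Unique-∖ [ v ] uH₁) U⊆R ⟩
          good R                       ∎
          where
          open ≤-Reasoning
          H₁ = take (suc k) Q
          U = H₁ ∖ [ v ]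
          uH₁ : Unique H₁
          uH₁ = take⁺ (suc k) uQ
          |U|≡k : length U ≡ k
          |U|≡k = suc-injective (trans (sym (length-∖-∈ uH₁ v∈H₁))
                    (trans (length-take (suc k) Q) (trans (cong (suc k ⊓_) lenQ) (m≤n⇒m⊓n≡m (m≤m+n (suc k) (suc k))))))
          R∖U≡S∖H₁ : R ∖ U ≡ S ∖ H₁
          R∖U≡S∖H₁ = trans (∖-∖ S [ v ] U) (∖-cong S to from)
            where
            to : ∀ {y} → y ∈ [ v ] ++ U → y ∈ H₁
            to (here refl) = v∈H₁
            to (there y∈U) = proj₁ (∈-∖⁻ {S = H₁} y∈U)
            from : ∀ {y} → y ∈ H₁ → y ∈ [ v ] ++ U
            from {y} y∈H₁ with y ≟ v
            ... | yes refl = here refl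
            ... | no  y≢v  = there (∈-∖⁺ y∈H₁ λ { (here y≡v) → y≢v y≡v })
          U⊆R : All (_∈ R) U
          U⊆R = All.tabulate λ y∈U →
            ∈-∖⁺ (All.lookup Q⊆S (H₁⊆Q (proj₁ (∈-∖⁻ {S = H₁} y∈U)))) (proj₂ (∈-∖⁻ {S = H₁} y∈U))
            where
            H₁⊆Q : ∀ {y} → y ∈ H₁ → y ∈ Q
            H₁⊆Q {y} = subst (y ∈_) (take++drop≡id (suc k) Q) ∘ ∈-++⁺ˡ

        squareThrough-count : ∀ k Q → β ^ k * sumExt L S z (𝟙 ∘ squareThrough? (suc k) Q) ≤ good R
        squareThrough-count k Q = by-cases (halfPath? (suc k) Q)
          where
          by-cases : Dec (HalfPath (suc k) Q) → β ^ k * sumExt L S z (𝟙 ∘ squareThrough? (suc k) Q) ≤ good R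
          by-cases (yes half) = ≤-trans (*-monoʳ-≤ (β ^ k) (squareThrough≤good-∖ half)) (good-∖-half≤ half)
          by-cases (no ¬half) = ≤-trans (≤-reflexive (trans (cong (β ^ k *_) none) (*-zeroʳ (β ^ k)))) z≤n
            where
            none : sumExt L S z (𝟙 ∘ squareThrough? (suc k) Q) ≡ 0
            none = trans (sumExt-cong L S z (λ w → 𝟙-no (squareThrough? (suc k) Q w) (¬half ∘ proj₁))) (sumExt-zero L S z)

        squaresThrough : ℕ → Colouring G → ℕ
        squaresThrough k w = sumMap (λ Q → 𝟙 (squareThrough? (suc k) Q w)) (halfPaths G v (suc k))

        newSquare≤squaresThrough : ∀ w → 𝟙 (newSquare? w) ≤ sumMap (λ k → squaresThrough k w) (downFrom n)
        newSquare≤squaresThrough w with newSquare? w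
        ... | no  _  = z≤n
        ... | yes ns with newSquare⇒squareThrough {w} ns
        ...   | k , k<n , Q , Q∈ , st = begin
          1                                            ≡⟨ 𝟙-yes (squareThrough? (suc k) Q w) st ⟨
          𝟙 (squareThrough? (suc k) Q w)               ≤⟨ term≤sumMap (λ Q → 𝟙 (squareThrough? (suc k) Q w)) Q∈ ⟩
          squaresThrough k w                           ≤⟨ term≤sumMap (λ k → squaresThrough k w) (∈-downFrom⁺ k<n) ⟩
          sumMap (λ k → squaresThrough k w) (downFrom n) ∎
          where open ≤-Reasoning

        squaresThroughCount : ℕ → ℕ
        squaresThroughCount k = sumExt L S z (squaresThrough k)

        newSquares≤ : sumExt L S z (𝟙 ∘ newSquare?) ≤ sumMap squaresThroughCount (downFrom n)
        newSquares≤ = ≤-trans (sumExt-mono L S z (λ w _ → newSquare≤squaresThrough w))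
                              (≤-reflexive (sumExt-sumMap L squaresThrough (downFrom n) S z))

        squaresThroughCount-bound : ∀ k → β ^ k * squaresThroughCount k ≤ suc k * (pred Δ * pred Δ) ^ k * (Δ * good R)
        squaresThroughCount-bound k = begin
          β ^ k * squaresThroughCount k
            ≡⟨ cong (β ^ k *_) (sumExt-sumMap L (λ Q w → 𝟙 (squareThrough? (suc k) Q w)) (halfPaths G v (suc k)) S z) ⟩
          β ^ k * sumMap (λ Q → sumExt L S z (𝟙 ∘ squareThrough? (suc k) Q)) (halfPaths G v (suc k))
            ≡⟨ sumMap-*ˡ (β ^ k) _ (halfPaths G v (suc k)) ⟨
          sumMap (λ Q → β ^ k * sumExt L S z (𝟙 ∘ squareThrough? (suc k) Q)) (halfPaths G v (suc k))
            ≤⟨ sumMap-≤-length* _ (good R) (halfPaths G v (suc k)) (λ {Q} _ → squareThrough-count k Q) ⟩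
          length (halfPaths G v (suc k)) * good R
            ≤⟨ *-monoˡ-≤ (good R) (length-halfPaths G v k) ⟩
          suc k * (Δ * pred Δ ^ (k + k)) * good R
            ≡⟨ cong (λ t → suc k * (Δ * t) * good R) (^-double (pred Δ) k) ⟩
          suc k * (Δ * (pred Δ * pred Δ) ^ k) * good R
            ≡⟨ regroup (suc k) Δ ((pred Δ * pred Δ) ^ k) (good R) ⟩
          suc k * (pred Δ * pred Δ) ^ k * (Δ * good R) ∎
          where
          open ≤-Reasoning
          regroup : ∀ k D P g → k * (D * P) * g ≡ k * P * (D * g)
          regroup = solve-∀

    module _ (e c : ℕ) (e≥1 : 1 ≤ e) (Δβ²≤ce² : Δ * ((pred Δ * pred Δ + e) * (pred Δ * pred Δ + e)) ≤ c * (e * e))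
             (long : ∀ x → pred Δ * pred Δ + e + c ≤ length (L x)) where

      private
        β = pred Δ * pred Δ + e

      good-step : ∀ m {S v} → length S ≤ m → Unique S → v ∈ S → β * good (S ∖ [ v ]) ≤ good S
      good-step zero    {x ∷ _} () _ _
      good-step (suc m) {S} {v} |S|≤1+m uS v∈S = +-cancelʳ-≤ (c * good R) _ _ (begin
        β * good R + c * good R                           ≡⟨ *-distribʳ-+ (good R) β c ⟨
        (β + c) * good R                                  ≤⟨ *-monoˡ-≤ (good R) (long v) ⟩
        length (L v) * good R                             ≤⟨ good-split uS v∈S ⟩
        good S + sumExt L S z (𝟙 ∘ newSquare? uS v∈S)     ≤⟨ +-monoʳ-≤ (good S) newSquares≤c*goodR ⟩
        good S + c * good R                               ∎)
        where
        open ≤-Reasoning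
        R = S ∖ [ v ]
        chainR : ∀ U → Unique U → All (_∈ R) U → β ^ length U * good (R ∖ U) ≤ good R
        chainR U uU U⊆R = good-chain β m (good-step m) U uU (Unique-∖ [ v ] uS) U⊆R
                            (≤-pred (≤-trans (≤-reflexive (sym (length-∖-∈ uS v∈S))) |S|≤1+m))
        newSquares≤c*goodR : sumExt L S z (𝟙 ∘ newSquare? uS v∈S) ≤ c * good R
        newSquares≤c*goodR = *-cancelˡ-≤ (e * e) {{>-nonZero (*-mono-≤ e≥1 e≥1)}} (begin
          e * e * sumExt L S z (𝟙 ∘ newSquare? uS v∈S)
            ≤⟨ *-monoʳ-≤ (e * e) (newSquares≤ uS v∈S β chainR) ⟩
          e * e * sumMap (squaresThroughCount uS v∈S β chainR) (downFrom n)
            ≤⟨ e²*sum≤β²A (pred Δ * pred Δ) e _ (Δ * good R) (squaresThroughCount-bound uS v∈S β chainR) e≥1 n ⟩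
          β * β * (Δ * good R)
            ≡⟨ x∙yz≈yx∙z (β * β) Δ (good R) ⟩
          Δ * (β * β) * good R
            ≤⟨ *-monoˡ-≤ (good R) Δβ²≤ce² ⟩
          c * (e * e) * good R
            ≡⟨ xy∙z≈y∙xz c (e * e) (good R) ⟩
          e * e * (c * good R) ∎)

      good-allFin>0 : 0 < good (allFin n)
      good-allFin>0 = begin
        1
          ≤⟨ m^n>0 β {{>-nonZero (≤-trans e≥1 (m≤n+m e _))}} n ⟩
        β ^ n
          ≡⟨ *-identityʳ (β ^ n) ⟨
        β ^ n * 1
          ≡⟨ cong₂ (λ i g → β ^ i * g) (length-tabulate {n = n} id) (trans (cong good all∖all) good[]≡1) ⟨
        β ^ length (allFin n) * good (allFin n ∖ allFin n)
          ≤⟨ good-chain β n (good-step n) (allFin n) (allFin⁺ n) (allFin⁺ n)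
                        (All.universal ∈-allFin (allFin n)) (≤-reflexive (length-tabulate id)) ⟩
        good (allFin n) ∎
        where
        open ≤-Reasoning
        all∖all : allFin n ∖ allFin n ≡ []
        all∖all = filter-none (_∉? allFin n) (All.universal (λ x x∉ → x∉ (∈-allFin x)) (allFin n))

      squareFreeColouring : ∃[ w ] (∀ y → lookup w y ∈ L y) × SquareFree (allFin n) w
      squareFreeColouring with sumExt-pos L (allFin n) z (𝟙 ∘ squareFree? (allFin n)) good-allFin>0
      ... | w , _ , coloured , sf>0 = w , (λ y → coloured (∈-allFin y)) , 𝟙-pos (squareFree? (allFin n) w) sf>0

  nonRepChoosable : ∀ e c → 1 ≤ e → Δ * ((pred Δ * pred Δ + e) * (pred Δ * pred Δ + e)) ≤ c * (e * e) →
    NonRepChoosable G (pred Δ * pred Δ + e + c)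
  nonRepChoosable e c e≥1 Δβ²≤ce² L lists with squareFreeColouring L (proj₁ ∘ lists) e c e≥1 Δβ²≤ce² (proj₂ ∘ lists)
  ... | w , coloured , sf = lookup w , coloured , nonRepColoring G w sf

theorem2 : ∀ (n : ℕ) (G : Graph n) → 1 ≤ maxDegree G →
    Σ ℕ (λ l → NonRepChoosable G l × BoundHolds (maxDegree G) l)
theorem2 n G Δ≥1 with parameters (maxDegree G) Δ≥1
... | e , c , e≥1 , Δβ²≤ce² , bound =
  l , nonRepChoosable G e c e≥1 Δβ²≤ce² , BoundBy⇒BoundHolds {maxDegree G} {l} Δ≥1 bound
  where
  l = pred (maxDegree G) * pred (maxDegree G) + e + c
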